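{- As $d\to\infty$, $$\mathrm{mdim}(Q_d)\sim \mathrm{edim}(Q_d)\sim \dim(Q_d)\sim \frac{2d}{\log_2 d},$$ where $f(d)\sim g(d)$ means $f(d)/g(d)\to 1$.
   Context: The hypercube $Q_d$ has vertex set $\{0,1\}^d$, two vertices adjacent iff they differ in exactly one coordinate; distance is the number of differing coordinates. For a vertex $x$ and an edge $uv$, $d(uv,x)=\min\{d(u,x),d(v,x)\}$. A set $S$ of vertices is a metric generator (resp. edge metric generator, mixed metric generator) if every two distinct vertices (resp. every two distinct edges, every two distinct elements of $V\cup E$) $a,b$ have some $s\in S$ with $d(a,s)\ne d(b,s)$. $\dim$, $\mathrm{edim}$, $\mathrm{mdim}$ denote the minimum cardinalities of a metric generator, an edge metric generator and a mixed metric generator, respectively. -}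

module Defs where

open import Data.Bool using (Bool; true; false; not; _≟_)
open import Data.Nat using (ℕ; zero; suc; _+_; _*_; _∸_; _^_; _≤_; _<_; _⊔_; _⊓_; NonZero)
open import Data.Fin using (Fin)
open import Data.Vec using (Vec; []; _∷_; lookup; _[_]≔_)
open import Data.List using (List; length)
open import Data.List.Membership.Propositional using (_∈_)
open import Data.Product using (Σ; ∃; _×_; _,_; proj₁)
open import Data.Sum using (_⊎_; inj₁; inj₂)
open import Relation.Binary.PropositionalEquality using (_≡_; _≢_)
open import Relation.Nullary using (¬_)

Vertex : ℕ → Set
Vertex d = Vec Bool d

-- Hamming distance = graph distance in Q_d
dist : ∀ {d} → Vertex d → Vertex d → ℕ
dist [] [] = 0
dist (a ∷ u) (b ∷ v) with a ≟ b
... | Relation.Nullary.yes _ = dist u v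
... | Relation.Nullary.no _ = suc (dist u v)

flip : ∀ {d} → Vertex d → Fin d → Vertex d
flip u i = u [ i ]≔ not (lookup u i)

-- An edge of Q_d, represented uniquely by its endpoint u with u_i = 0
-- and the coordinate i in which the endpoints differ; endpoints u, flip u i.
Edge : ℕ → Set
Edge d = Σ (Vertex d × Fin d) (λ p → lookup (proj₁ p) (Data.Product.proj₂ p) ≡ false)

endpoint₁ : ∀ {d} → Edge d → Vertex d
endpoint₁ ((u , i) , _) = u

endpoint₂ : ∀ {d} → Edge d → Vertex d
endpoint₂ ((u , i) , _) = flip u i

edist : ∀ {d} → Edge d → Vertex d → ℕ
edist e x = dist (endpoint₁ e) x ⊓ dist (endpoint₂ e) x

Elem : ℕ → Set
Elem d = Vertex d ⊎ Edge d

eldist : ∀ {d} → Elem d → Vertex d → ℕ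
eldist (inj₁ v) x = dist v x
eldist (inj₂ e) x = edist e x

Resolves : ∀ {d} {A : Set} → (A → Vertex d → ℕ) → List (Vertex d) → Set
Resolves {d} {A} δ S = (a b : A) → a ≢ b → ∃ λ s → s ∈ S × δ a s ≢ δ b s

MetricGenerator : ∀ d → List (Vertex d) → Set
MetricGenerator d = Resolves {d} dist

EdgeMetricGenerator : ∀ d → List (Vertex d) → Set
EdgeMetricGenerator d = Resolves {d} edist

MixedMetricGenerator : ∀ d → List (Vertex d) → Set
MixedMetricGenerator d = Resolves {d} eldist

-- k is the minimum cardinality of a set of vertices satisfying Gen
-- (sets represented by lists; a list of length k attains it, and every
-- generating list has length ≥ k, so duplicates do not matter)
IsMinCard : ∀ {d} → (List (Vertex d) → Set) → ℕ → Set
IsMinCard {d} Gen k =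
  (∃ λ (S : List (Vertex d)) → length S ≡ k × Gen S)
  × ((S : List (Vertex d)) → Gen S → k ≤ length S)

IsDim IsEdim IsMdim : ℕ → ℕ → Set
IsDim d = IsMinCard (MetricGenerator d)
IsEdim d = IsMinCard (EdgeMetricGenerator d)
IsMdim d = IsMinCard (MixedMetricGenerator d)

-- f(d) ~ 2d / log₂ d, i.e. f(d) log₂ d / (2d) → 1.
-- For every rational ε = p/q > 0 there is N with, for all d ≥ N,
--   (1 - ε)·2d ≤ f(d)·log₂ d ≤ (1 + ε)·2d,
-- which (multiplying by q and exponentiating base 2) is exactly
--   2^(2d(q - p)) ≤ d^(q·f(d)) ≤ 2^(2d(q + p))
-- (for p ≥ q the lower bound is vacuous and ∸ gives 2^0 = 1 ≤ d^…, d ≥ 1).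
AsympTo2dOverLog : (ℕ → ℕ) → Set
AsympTo2dOverLog f =
  (p q : ℕ) → 0 < p → 0 < q →
  ∃ λ N → (d : ℕ) → N ≤ d →
    (2 ^ (2 * d * (q ∸ p)) ≤ d ^ (q * f d)) × (d ^ (q * f d) ≤ 2 ^ (2 * d * (q + p)))

{-# OPTIONS --safe #-}
-- Upper bound: if the inner products s · x with the vectors s of a family Q determine x ∈ {0,1}ⁿ, then Q
-- together with the all-zeros and all-ones vertices resolves every vertex and edge of Qₙ, because
-- d(x,s) = |x| + |s| − 2 s · x and an edge is seen through its endpoint with a zero in the edge direction.
-- A doubling construction gives such families of 2^(J+1) − 1 vectors in dimension J 2^J + 1; placing copies
-- side by side reaches every dimension, so mdim(Q_d) ≤ (1 + o(1)) 2d / log₂ d, and dim, edim ≤ mdim.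
--
-- Lower bound: if S resolves the vertices of Q_d, then for each s the deviation 2 d(x,s) − d has mean square
-- d over the cube, so at least half of the vertices satisfy Σ_s (2 d(x,s) − d)² ≤ 2 |S| d. Writing the
-- deviations of such a vertex in base u ≈ √d, their quotients sum to at most 2 |S|, so 2^(d−1) vertices inject
-- into 8^|S| (2u)^|S| codes and dim(Q_d) ≥ (1 − o(1)) 2d / log₂ d. The edges of one direction of Q_(d+1)
-- form a copy of Q_d, so the same bound holds for edim, and every mixed generator resolves the vertices.
module Submission where

open import Defs
open import Axiom.UniquenessOfIdentityProofs using (module Decidable⇒UIP)
open import Data.Bool as Bool using (Bool; true; false; not; _∧_)
open import Data.Bool.Properties using (∧-comm)
open import Data.Empty using (⊥; ⊥-elim)
open import Data.Fin using (Fin; zero; suc; _↑ˡ_; _↑ʳ_)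
import Data.Fin.Properties as Fin
open import Data.Integer as ℤ using (ℤ; ∣_∣)
import Data.Integer.Properties as ℤ
import Data.Integer.Tactic.RingSolver as ℤ
open import Data.List as List using (List; []; _∷_; length; map; filter)
import Data.List.Properties as List
open import Data.List.Membership.Propositional using (_∈_; _─_; find)
open import Data.List.Membership.Propositional.Properties using (∈-map⁺; ∈-map⁻; ∈-++⁺ˡ; ∈-++⁺ʳ; ∈-filter⁻; ∈-tabulate⁺)
open import Data.List.Relation.Unary.All as All using (All; all?; []; _∷_)
import Data.List.Relation.Unary.All.Properties as All
import Data.List.Relation.Unary.AllPairs as AllPairs
open import Data.List.Relation.Unary.Any as Any using (here; there)
open import Data.List.Relation.Unary.Unique.Propositional using (Unique)
import Data.List.Relation.Unary.Unique.Propositional.Properties as Unique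
open import Data.Nat
open import Data.Nat.DivMod using (_/_; _%_; m≡m%n+[m/n]*n; m%n<n; m/n*n≤m; /-monoˡ-≤; m*n/n≡m)
open import Data.Nat.Properties
open import Data.Nat.Tactic.RingSolver using (solve-∀)
open import Data.Product using (Σ; ∃; _×_; _,_; proj₁; proj₂)
open import Data.Sign as Sign using (Sign)
open import Data.Sum using (inj₁; inj₂; [_,_]′)
open import Data.Vec as Vec using (Vec; []; _∷_; _++_; lookup; replicate; _[_]≔_)
import Data.Vec.Properties as Vec
open import Data.Vec.Functional using (Vector)
import Data.Vec.Functional as F
open import Data.Vec.Functional.Properties using (lookup-++ˡ; lookup-++ʳ)
open import Function using (_∘_; id)
open import Relation.Binary.Definitions using (DecidableEquality)
open import Relation.Binary.PropositionalEquality hiding (J)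
open import Relation.Nullary using (yes; no; contradiction)

variable
  d n m : ℕ
  A : Set

-- Resolving sets

Agree : (A → Vertex d → ℕ) → List (Vertex d) → A → A → Set
Agree δ S a b = All (λ s → δ a s ≡ δ b s) S

resolves⁺ : (δ : A → Vertex d → ℕ) (S : List (Vertex d)) →
            (∀ a b → Agree δ S a b → a ≡ b) → Resolves δ S
resolves⁺ δ S agree⇒≡ a b a≢b with all? (λ s → δ a s ≟ δ b s) S
... | yes agree = contradiction (agree⇒≡ a b agree) a≢b
... | no ¬agree = find (All.¬All⇒Any¬ (λ s → δ a s ≟ δ b s) S ¬agree)

resolves⁻ : DecidableEquality A → {δ : A → Vertex d → ℕ} {S : List (Vertex d)} →
            Resolves δ S → ∀ a b → Agree δ S a b → a ≡ b
resolves⁻ _≟ᴬ_ res a b agree with a ≟ᴬ b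
... | yes a≡b = a≡b
... | no a≢b = let _ , s∈S , δa≢δb = res a b a≢b in contradiction (All.lookup agree s∈S) δa≢δb

mixed⇒metric : ∀ {S} → MixedMetricGenerator d S → MetricGenerator d S
mixed⇒metric res x y x≢y = res (inj₁ x) (inj₁ y) λ { refl → x≢y refl }

mixed⇒edge : ∀ {S} → MixedMetricGenerator d S → EdgeMetricGenerator d S
mixed⇒edge res e f e≢f = res (inj₂ e) (inj₂ f) λ { refl → e≢f refl }

edge₀ : Vertex d → Edge (suc d)
edge₀ x = ((false ∷ x) , zero) , refl

edist-edge₀ : (x : Vertex d) (s : Vertex (suc d)) → edist (edge₀ x) s ≡ dist x (Vec.tail s)
edist-edge₀ x (false ∷ s) = m≤n⇒m⊓n≡m (n≤1+n _)
edist-edge₀ x (true ∷ s) = m≥n⇒m⊓n≡n (n≤1+n _)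

edge⇒metric : ∀ {S} → EdgeMetricGenerator (suc d) S → MetricGenerator d (map Vec.tail S)
edge⇒metric res x y x≢y with res (edge₀ x) (edge₀ y) (λ { refl → x≢y refl })
... | s , s∈S , ≢ = Vec.tail s , ∈-map⁺ Vec.tail s∈S ,
    λ eq → ≢ (trans (edist-edge₀ x s) (trans eq (sym (edist-edge₀ y s))))

-- Distances and inner products on the cube

bit : Bool → ℕ
bit false = 0
bit true = 1

weight : Vec Bool n → ℕ
weight [] = 0
weight (a ∷ x) = bit a + weight x

infix 7 _·_

_·_ : Vec Bool n → Vec Bool n → ℕ
[] · [] = 0
(a ∷ s) · (b ∷ x) = bit (a ∧ b) + s · x

zeros ones : Vec Bool n
zeros = replicate _ false
ones = replicate _ true

unit : Fin n → Vec Bool n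
unit i = zeros [ i ]≔ true

·-comm : (s x : Vec Bool n) → s · x ≡ x · s
·-comm [] [] = refl
·-comm (a ∷ s) (b ∷ x) = cong₂ (λ c m → bit c + m) (∧-comm a b) (·-comm s x)

·-++ : ∀ {k} (s x : Vec Bool n) (t y : Vec Bool k) → (s ++ t) · (x ++ y) ≡ s · x + t · y
·-++ [] [] t y = refl
·-++ (a ∷ s) (b ∷ x) t y = trans (cong (bit (a ∧ b) +_) (·-++ s x t y)) (sym (+-assoc (bit (a ∧ b)) _ _))

zeros· : (x : Vec Bool n) → zeros · x ≡ 0
zeros· [] = refl
zeros· (_ ∷ x) = zeros· x

ones· : (x : Vec Bool n) → ones · x ≡ weight x
ones· [] = refl
ones· (b ∷ x) = cong (bit b +_) (ones· x)

unit· : (i : Fin n) (x : Vec Bool n) → unit i · x ≡ bit (lookup x i)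
unit· zero (b ∷ x) = trans (cong (bit b +_) (zeros· x)) (+-identityʳ (bit b))
unit· (suc i) (_ ∷ x) = unit· i x

not·+· : (s x : Vec Bool n) → Vec.map not s · x + s · x ≡ weight x
not·+· [] [] = refl
not·+· (true ∷ s) (b ∷ x) = trans (rearrange (Vec.map not s · x) (bit b) (s · x)) (cong (bit b +_) (not·+· s x))
  where rearrange : ∀ m n o → m + (n + o) ≡ n + (m + o)
        rearrange = solve-∀
not·+· (false ∷ s) (b ∷ x) = trans (+-assoc (bit b) _ _) (cong (bit b +_) (not·+· s x))

dist+2·≡weight+weight : (x s : Vec Bool n) → dist x s + 2 * (s · x) ≡ weight x + weight s
dist+2·≡weight+weight [] [] = refl
dist+2·≡weight+weight (true ∷ x) (true ∷ s) =
  trans (rearrange (dist x s) (s · x))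
        (trans (cong (2 +_) (dist+2·≡weight+weight x s)) (cong suc (sym (+-suc (weight x) (weight s)))))
  where rearrange : ∀ m n → m + 2 * (1 + n) ≡ 2 + (m + 2 * n)
        rearrange = solve-∀
dist+2·≡weight+weight (true ∷ x) (false ∷ s) = cong suc (dist+2·≡weight+weight x s)
dist+2·≡weight+weight (false ∷ x) (true ∷ s) = trans (cong suc (dist+2·≡weight+weight x s)) (sym (+-suc (weight x) (weight s)))
dist+2·≡weight+weight (false ∷ x) (false ∷ s) = dist+2·≡weight+weight x s

dist-zeros : (x : Vec Bool n) → dist x zeros ≡ weight x
dist-zeros [] = refl
dist-zeros (true ∷ x) = cong suc (dist-zeros x)
dist-zeros (false ∷ x) = dist-zeros x

dist-ones : (x : Vec Bool n) → dist x ones + weight x ≡ n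
dist-ones [] = refl
dist-ones (true ∷ x) = trans (+-suc _ _) (cong suc (dist-ones x))
dist-ones (false ∷ x) = cong suc (dist-ones x)

dist-endpoint₁ : (u s : Vec Bool n) (i : Fin n) → lookup u i ≡ false →
                 dist u s ≡ bit (lookup s i) + dist u s ⊓ dist (flip u i) s
dist-endpoint₁ (false ∷ u) (true ∷ s) zero _ = cong suc (sym (m≥n⇒m⊓n≡n (n≤1+n _)))
dist-endpoint₁ (false ∷ u) (false ∷ s) zero _ = sym (m≤n⇒m⊓n≡m (n≤1+n _))
dist-endpoint₁ (true ∷ u) (true ∷ s) (suc i) uᵢ≡false = dist-endpoint₁ u s i uᵢ≡false
dist-endpoint₁ (false ∷ u) (false ∷ s) (suc i) uᵢ≡false = dist-endpoint₁ u s i uᵢ≡false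
dist-endpoint₁ (true ∷ u) (false ∷ s) (suc i) uᵢ≡false =
  trans (cong suc (dist-endpoint₁ u s i uᵢ≡false)) (sym (+-suc (bit (lookup s i)) _))
dist-endpoint₁ (false ∷ u) (true ∷ s) (suc i) uᵢ≡false =
  trans (cong suc (dist-endpoint₁ u s i uᵢ≡false)) (sym (+-suc (bit (lookup s i)) _))

edist-via-· : (u s : Vec Bool n) (i : Fin n) (uᵢ≡false : lookup u i ≡ false) →
              edist ((u , i) , uᵢ≡false) s + (bit (lookup s i) + 2 * (s · u)) ≡ weight u + weight s
edist-via-· u s i uᵢ≡false = begin
  E + (bit (lookup s i) + 2 * (s · u))  ≡⟨ rearrange E (bit (lookup s i)) (2 * (s · u)) ⟩
  (bit (lookup s i) + E) + 2 * (s · u)  ≡⟨ cong (_+ 2 * (s · u)) (dist-endpoint₁ u s i uᵢ≡false) ⟨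
  dist u s + 2 * (s · u)                ≡⟨ dist+2·≡weight+weight u s ⟩
  weight u + weight s                   ∎
  where
  open ≡-Reasoning
  E = edist ((u , i) , uᵢ≡false) s
  rearrange : ∀ m n o → m + (n + o) ≡ (n + m) + o
  rearrange = solve-∀

edist-zeros : (e : Edge n) → edist e zeros ≡ weight (endpoint₁ e)
edist-zeros ((u , i) , uᵢ≡false) = begin
  edist ((u , i) , uᵢ≡false) zeros            ≡⟨ cong (λ b → bit b + edist ((u , i) , uᵢ≡false) zeros) (Vec.lookup-replicate i false) ⟨
  bit (lookup zeros i) + edist ((u , i) , uᵢ≡false) zeros  ≡⟨ dist-endpoint₁ u zeros i uᵢ≡false ⟨
  dist u zeros                                 ≡⟨ dist-zeros u ⟩
  weight u                                     ∎
  where open ≡-Reasoning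

dist-ones+dist-zeros : (x : Vec Bool n) → dist x ones + dist x zeros ≡ n
dist-ones+dist-zeros x = trans (cong (dist x ones +_) (dist-zeros x)) (dist-ones x)

edist-ones+edist-zeros : (e : Edge n) → suc (edist e ones + edist e zeros) ≡ n
edist-ones+edist-zeros {n} e@((u , i) , uᵢ≡false) = begin
  suc (edist e ones + edist e zeros)   ≡⟨ cong₂ (λ b w → bit b + edist e ones + w) (Vec.lookup-replicate i true) (sym (edist-zeros e)) ⟨
  bit (lookup ones i) + edist e ones + weight u  ≡⟨ cong (_+ weight u) (dist-endpoint₁ u ones i uᵢ≡false) ⟨
  dist u ones + weight u               ≡⟨ dist-ones u ⟩
  n                                    ∎
  where open ≡-Reasoning

bit-parity : ∀ a b m n → bit a + 2 * m ≡ bit b + 2 * n → a ≡ b × m ≡ n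
bit-parity false false m n eq = refl , *-cancelˡ-≡ m n 2 eq
bit-parity true true m n eq = refl , *-cancelˡ-≡ m n 2 (suc-injective eq)
bit-parity false true m n eq = contradiction eq (even≢odd m n)
bit-parity true false m n eq = contradiction (sym eq) (even≢odd n m)

unit-injective : {i j : Fin n} → unit i ≡ unit j → i ≡ j
unit-injective {i = i} {j} uᵢ≡uⱼ with i Fin.≟ j
... | yes i≡j = i≡j
... | no i≢j = contradiction (begin
  true                ≡⟨ Vec.lookup∘update i zeros true ⟨
  lookup (unit i) i   ≡⟨ cong (λ v → lookup v i) uᵢ≡uⱼ ⟩
  lookup (unit j) i   ≡⟨ Vec.lookup∘update′ i≢j zeros true ⟩
  lookup zeros i      ≡⟨ Vec.lookup-replicate i false ⟩
  false               ∎) λ ()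
  where open ≡-Reasoning

-- Detecting families of queries

Family : ℕ → ℕ → Set
Family n m = Vector (Vec Bool n) m

SameAnswers : Family n m → Vec Bool n → Vec Bool n → Set
SameAnswers Q x y = ∀ r → Q r · x ≡ Q r · y

Detecting : Family n m → Set
Detecting {n} Q = (x y : Vec Bool n) → SameAnswers Q x y → x ≡ y

-- The landmarks 0 and 1 reveal the weight of a vertex and tell vertices from edges:
-- d(x,0) + d(x,1) is n for a vertex but n − 1 for an edge.
mixedGenerator : Family n m → List (Vertex n)
mixedGenerator Q = zeros ∷ ones ∷ List.tabulate Q

length-mixedGenerator : (Q : Family n m) → length (mixedGenerator Q) ≡ 2 + m
length-mixedGenerator Q = cong (2 +_) (List.length-tabulate Q)

·-determined-by-dist : {x y : Vec Bool n} (s : Vec Bool n) → dist x zeros ≡ dist y zeros →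
                       dist x s ≡ dist y s → s · x ≡ s · y
·-determined-by-dist {x = x} {y} s x₀≡y₀ xₛ≡yₛ = *-cancelˡ-≡ _ _ 2 (+-cancelˡ-≡ (dist x s) _ _ (begin
  dist x s + 2 * (s · x)  ≡⟨ dist+2·≡weight+weight x s ⟩
  weight x + weight s     ≡⟨ cong (_+ weight s) (trans (sym (dist-zeros x)) (trans x₀≡y₀ (dist-zeros y))) ⟩
  weight y + weight s     ≡⟨ dist+2·≡weight+weight y s ⟨
  dist y s + 2 * (s · y)  ≡⟨ cong (_+ 2 * (s · y)) xₛ≡yₛ ⟨
  dist x s + 2 * (s · y)  ∎))
  where open ≡-Reasoning

vertex-edge-separated : (x : Vec Bool n) (e : Edge n) → dist x zeros ≡ edist e zeros →
                        dist x ones ≡ edist e ones → ⊥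
vertex-edge-separated x e x₀≡e₀ x₁≡e₁ = 1+n≢n (begin
  suc (dist x ones + dist x zeros)   ≡⟨ cong₂ (λ a b → suc (a + b)) x₁≡e₁ x₀≡e₀ ⟩
  suc (edist e ones + edist e zeros) ≡⟨ edist-ones+edist-zeros e ⟩
  _                                  ≡⟨ dist-ones+dist-zeros x ⟨
  dist x ones + dist x zeros         ∎)
  where open ≡-Reasoning

edge-readings : (u u′ s : Vec Bool n) (i i′ : Fin n) (p : lookup u i ≡ false) (p′ : lookup u′ i′ ≡ false) →
                edist ((u , i) , p) zeros ≡ edist ((u′ , i′) , p′) zeros →
                edist ((u , i) , p) s ≡ edist ((u′ , i′) , p′) s →
                lookup s i ≡ lookup s i′ × s · u ≡ s · u′
edge-readings u u′ s i i′ p p′ e₀≡e′₀ eₛ≡e′ₛ = bit-parity _ _ _ _ (+-cancelˡ-≡ (edist ((u , i) , p) s) _ _ (begin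
  edist ((u , i) , p) s + (bit (lookup s i) + 2 * (s · u))      ≡⟨ edist-via-· u s i p ⟩
  weight u + weight s                                           ≡⟨ cong (_+ weight s) wu≡wu′ ⟩
  weight u′ + weight s                                          ≡⟨ edist-via-· u′ s i′ p′ ⟨
  edist ((u′ , i′) , p′) s + (bit (lookup s i′) + 2 * (s · u′))  ≡⟨ cong (_+ _) eₛ≡e′ₛ ⟨
  edist ((u , i) , p) s + (bit (lookup s i′) + 2 * (s · u′))     ∎))
  where
  open ≡-Reasoning
  wu≡wu′ : weight u ≡ weight u′
  wu≡wu′ = trans (sym (edist-zeros ((u , i) , p))) (trans e₀≡e′₀ (edist-zeros ((u′ , i′) , p′)))

mixed-generator : {Q : Family n m} → Detecting Q → MixedMetricGenerator n (mixedGenerator Q)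
mixed-generator {Q = Q} detect = resolves⁺ eldist (mixedGenerator Q) agree⇒≡
  where
  agree⇒≡ : ∀ a b → Agree eldist (mixedGenerator Q) a b → a ≡ b
  agree⇒≡ (inj₁ x) (inj₁ y) (x₀≡y₀ ∷ _ ∷ agreeQ) =
    cong inj₁ (detect x y λ r → ·-determined-by-dist (Q r) x₀≡y₀ (All.lookup agreeQ (∈-tabulate⁺ r)))
  agree⇒≡ (inj₁ x) (inj₂ e) (x₀≡e₀ ∷ x₁≡e₁ ∷ _) = ⊥-elim (vertex-edge-separated x e x₀≡e₀ x₁≡e₁)
  agree⇒≡ (inj₂ e) (inj₁ x) (e₀≡x₀ ∷ e₁≡x₁ ∷ _) = ⊥-elim (vertex-edge-separated x e (sym e₀≡x₀) (sym e₁≡x₁))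
  agree⇒≡ (inj₂ ((u , i) , p)) (inj₂ ((u′ , i′) , p′)) (e₀≡e′₀ ∷ _ ∷ agreeQ) = same-edge u≡u′ i≡i′
    where
    readings : ∀ r → lookup (Q r) i ≡ lookup (Q r) i′ × Q r · u ≡ Q r · u′
    readings r = edge-readings u u′ (Q r) i i′ p p′ e₀≡e′₀ (All.lookup agreeQ (∈-tabulate⁺ r))
    u≡u′ : u ≡ u′
    u≡u′ = detect u u′ λ r → proj₂ (readings r)
    i≡i′ : i ≡ i′
    i≡i′ = unit-injective (detect (unit i) (unit i′) λ r → begin
      Q r · unit i             ≡⟨ ·-comm (Q r) (unit i) ⟩
      unit i · Q r             ≡⟨ unit· i (Q r) ⟩
      bit (lookup (Q r) i)     ≡⟨ cong bit (proj₁ (readings r)) ⟩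
      bit (lookup (Q r) i′)    ≡⟨ unit· i′ (Q r) ⟨
      unit i′ · Q r            ≡⟨ ·-comm (unit i′) (Q r) ⟩
      Q r · unit i′            ∎)
      where open ≡-Reasoning
    same-edge : u ≡ u′ → i ≡ i′ → inj₂ ((u , i) , p) ≡ inj₂ ((u′ , i′) , p′)
    same-edge refl refl = cong (λ q → inj₂ ((u , i) , q)) (Decidable⇒UIP.≡-irrelevant Bool._≟_ p p′)

same-answers-++ˡ : ∀ {k} (P : Family n m) (Q : Family n k) {x y : Vec Bool n} →
                   SameAnswers (P F.++ Q) x y → SameAnswers P x y
same-answers-++ˡ {k = k} P Q {x} {y} same r = subst (λ v → v · x ≡ v · y) (lookup-++ˡ P Q r) (same (r ↑ˡ k))

same-answers-++ʳ : ∀ {k} (P : Family n m) (Q : Family n k) {x y : Vec Bool n} →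
                   SameAnswers (P F.++ Q) x y → SameAnswers Q x y
same-answers-++ʳ {m = m} P Q {x} {y} same r = subst (λ v → v · x ≡ v · y) (lookup-++ʳ P Q r) (same (m ↑ʳ r))

weightRow : ∀ n m → Vec Bool ((n + n) + m)
weightRow n m = (zeros {n} ++ ones {n}) ++ zeros {m}

sumRow differenceRow : Family n m → Family ((n + n) + m) m
sumRow Q r = (Q r ++ Q r) ++ unit r
differenceRow Q r = (Q r ++ Vec.map not (Q r)) ++ zeros

doubling : Family n m → Family ((n + n) + m) (suc (m + m))
doubling {n} {m} Q = weightRow n m F.∷ (sumRow Q F.++ differenceRow Q)

module _ (Q : Family n m) (a b : Vec Bool n) (c : Vec Bool m) where

  private
    x = (a ++ b) ++ c

  doubling-weight : weightRow n m · x ≡ weight b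
  doubling-weight = begin
    weightRow n m · x                             ≡⟨ ·-++ (zeros {n} ++ ones {n}) (a ++ b) (zeros {m}) c ⟩
    (zeros {n} ++ ones) · (a ++ b) + zeros · c    ≡⟨ cong₂ _+_ (·-++ (zeros {n}) a (ones {n}) b) (zeros· c) ⟩
    (zeros · a + ones · b) + 0                    ≡⟨ cong₂ (λ u v → u + v + 0) (zeros· a) (ones· b) ⟩
    weight b + 0                                  ≡⟨ +-identityʳ (weight b) ⟩
    weight b                                      ∎
    where open ≡-Reasoning

  doubling-sum : (r : Fin m) → sumRow Q r · x ≡ (Q r · a + Q r · b) + bit (lookup c r)
  doubling-sum r = trans (·-++ (Q r ++ Q r) (a ++ b) (unit r) c) (cong₂ _+_ (·-++ (Q r) a (Q r) b) (unit· r c))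

  doubling-difference : (r : Fin m) → differenceRow Q r · x ≡ Q r · a + Vec.map not (Q r) · b
  doubling-difference r = begin
    ((Q r ++ Vec.map not (Q r)) ++ zeros) · x          ≡⟨ ·-++ (Q r ++ Vec.map not (Q r)) (a ++ b) (zeros {m}) c ⟩
    (Q r ++ Vec.map not (Q r)) · (a ++ b) + zeros · c  ≡⟨ cong₂ _+_ (·-++ (Q r) a (Vec.map not (Q r)) b) (zeros· c) ⟩
    Q r · a + Vec.map not (Q r) · b + 0                ≡⟨ +-identityʳ _ ⟩
    Q r · a + Vec.map not (Q r) · b                    ∎
    where open ≡-Reasoning

  doubling-sum+difference : (r : Fin m) →
    sumRow Q r · x + differenceRow Q r · x ≡ (bit (lookup c r) + 2 * (Q r · a)) + weight b
  doubling-sum+difference r = begin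
    sumRow Q r · x + differenceRow Q r · x                        ≡⟨ cong₂ _+_ (doubling-sum r) (doubling-difference r) ⟩
    (Q r · a + Q r · b + bit (lookup c r)) + (Q r · a + N · b)    ≡⟨ rearrange (Q r · a) (Q r · b) (bit (lookup c r)) (N · b) ⟩
    (bit (lookup c r) + 2 * (Q r · a)) + (N · b + Q r · b)        ≡⟨ cong (_ +_) (not·+· (Q r) b) ⟩
    (bit (lookup c r) + 2 * (Q r · a)) + weight b                 ∎
    where
    open ≡-Reasoning
    N = Vec.map not (Q r)
    rearrange : ∀ A B C D → (A + B + C) + (A + D) ≡ (C + 2 * A) + (D + B)
    rearrange = solve-∀

-- On (a ++ b) ++ c a sum row and a difference row add up to c_r + 2 (Q r · a) + weight b,
-- so parity recovers c_r and Q r · a, after which the sum row yields Q r · b.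
doubling-detecting : {Q : Family n m} → Detecting Q → Detecting (doubling Q)
doubling-detecting {n} {Q = Q} detect x y same
  with Vec.splitAt (n + n) x | Vec.splitAt (n + n) y
... | ab , c , refl | ab′ , c′ , refl with Vec.splitAt n ab | Vec.splitAt n ab′
... | a , b , refl | a′ , b′ , refl = cong₂ _++_ (cong₂ _++_ a≡a′ b≡b′) c≡c′
  where
  open ≡-Reasoning
  sameSum : SameAnswers (sumRow Q) ((a ++ b) ++ c) ((a′ ++ b′) ++ c′)
  sameSum = same-answers-++ˡ (sumRow Q) (differenceRow Q) (same ∘ suc)
  sameDifference : SameAnswers (differenceRow Q) ((a ++ b) ++ c) ((a′ ++ b′) ++ c′)
  sameDifference = same-answers-++ʳ (sumRow Q) (differenceRow Q) (same ∘ suc)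
  wb≡wb′ : weight b ≡ weight b′
  wb≡wb′ = trans (sym (doubling-weight Q a b c)) (trans (same zero) (doubling-weight Q a′ b′ c′))
  readings : ∀ r → lookup c r ≡ lookup c′ r × Q r · a ≡ Q r · a′
  readings r = bit-parity _ _ _ _ (+-cancelʳ-≡ (weight b) _ _ (begin
    (bit (lookup c r) + 2 * (Q r · a)) + weight b     ≡⟨ doubling-sum+difference Q a b c r ⟨
    _                                                 ≡⟨ cong₂ _+_ (sameSum r) (sameDifference r) ⟩
    _                                                 ≡⟨ doubling-sum+difference Q a′ b′ c′ r ⟩
    (bit (lookup c′ r) + 2 * (Q r · a′)) + weight b′  ≡⟨ cong (_ +_) wb≡wb′ ⟨
    (bit (lookup c′ r) + 2 * (Q r · a′)) + weight b   ∎))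
  a≡a′ : a ≡ a′
  a≡a′ = detect a a′ (proj₂ ∘ readings)
  c≡c′ : c ≡ c′
  c≡c′ = begin
    c                            ≡⟨ Vec.tabulate∘lookup c ⟨
    Vec.tabulate (lookup c)      ≡⟨ Vec.tabulate-cong (proj₁ ∘ readings) ⟩
    Vec.tabulate (lookup c′)     ≡⟨ Vec.tabulate∘lookup c′ ⟩
    c′                           ∎
  b≡b′ : b ≡ b′
  b≡b′ = detect b b′ λ r → +-cancelˡ-≡ (Q r · a) _ _ (+-cancelʳ-≡ (bit (lookup c r)) _ _ (begin
    Q r · a + Q r · b + bit (lookup c r)     ≡⟨ doubling-sum Q a b c r ⟨
    _                                        ≡⟨ sameSum r ⟩
    _                                        ≡⟨ doubling-sum Q a′ b′ c′ r ⟩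
    Q r · a′ + Q r · b′ + bit (lookup c′ r)  ≡⟨ cong₂ (λ u v → u + Q r · b′ + bit v) (proj₂ (readings r)) (proj₁ (readings r)) ⟨
    Q r · a + Q r · b′ + bit (lookup c r)    ∎))

singleton : Family 1 1
singleton _ = true ∷ []

singleton-detecting : Detecting singleton
singleton-detecting (a ∷ []) (b ∷ []) same = cong (_∷ []) (proj₁ (bit-parity a b 0 0 (same zero)))

queries coordinates : ℕ → ℕ
queries zero = 1
queries (suc J) = suc (queries J + queries J)
coordinates zero = 1
coordinates (suc J) = (coordinates J + coordinates J) + queries J

iterated : ∀ J → Family (coordinates J) (queries J)
iterated zero = singleton
iterated (suc J) = doubling (iterated J)

iterated-detecting : ∀ J → Detecting (iterated J)
iterated-detecting zero = singleton-detecting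
iterated-detecting (suc J) = doubling-detecting {Q = iterated J} (iterated-detecting J)

queries-closed : ∀ J → suc (queries J) ≡ 2 ^ suc J
queries-closed zero = refl
queries-closed (suc J) = begin
  suc (suc (queries J + queries J))    ≡⟨ cong suc (+-suc (queries J) (queries J)) ⟨
  suc (queries J) + suc (queries J)    ≡⟨ cong₂ _+_ (queries-closed J) (queries-closed J) ⟩
  2 ^ suc J + 2 ^ suc J                ≡⟨ cong (2 ^ suc J +_) (+-identityʳ (2 ^ suc J)) ⟨
  2 ^ suc (suc J)                      ∎
  where open ≡-Reasoning

coordinates-closed : ∀ J → coordinates J ≡ J * 2 ^ J + 1
coordinates-closed zero = refl
coordinates-closed (suc J) = +-cancelʳ-≡ 1 _ _ (begin
  (coordinates J + coordinates J) + queries J + 1                     ≡⟨ +-assoc (coordinates J + coordinates J) (queries J) 1 ⟩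
  (coordinates J + coordinates J) + (queries J + 1)                   ≡⟨ cong₂ (λ u v → (u + u) + v) (coordinates-closed J) (trans (+-comm (queries J) 1) (queries-closed J)) ⟩
  ((J * 2 ^ J + 1) + (J * 2 ^ J + 1)) + 2 * 2 ^ J                     ≡⟨ rearrange J (2 ^ J) ⟩
  (suc J * (2 * 2 ^ J) + 1) + 1                                       ∎)
  where
  open ≡-Reasoning
  rearrange : ∀ J P → ((J * P + 1) + (J * P + 1)) + 2 * P ≡ (suc J * (2 * P) + 1) + 1
  rearrange = solve-∀

_⊕_ : ∀ {n m n′ m′} → Family n m → Family n′ m′ → Family (n + n′) (m + m′)
P ⊕ Q = (λ r → P r ++ zeros) F.++ (λ r → zeros ++ Q r)

⊕-detecting : ∀ {n m n′ m′} {P : Family n m} {Q : Family n′ m′} →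
              Detecting P → Detecting Q → Detecting (P ⊕ Q)
⊕-detecting {n} {n′ = n′} {P = P} {Q} detectP detectQ x y same
  with Vec.splitAt n x | Vec.splitAt n y
... | a , b , refl | a′ , b′ , refl = cong₂ _++_ a≡a′ b≡b′
  where
  left : ∀ r (a : Vec Bool n) (b : Vec Bool n′) → (P r ++ zeros) · (a ++ b) ≡ P r · a
  left r a b = trans (·-++ (P r) a zeros b) (trans (cong (P r · a +_) (zeros· b)) (+-identityʳ _))
  right : ∀ r (a : Vec Bool n) (b : Vec Bool n′) → (zeros ++ Q r) · (a ++ b) ≡ Q r · b
  right r a b = trans (·-++ zeros a (Q r) b) (cong (_+ Q r · b) (zeros· a))
  a≡a′ : a ≡ a′
  a≡a′ = detectP a a′ λ r →
    trans (sym (left r a b)) (trans (same-answers-++ˡ (λ r → P r ++ zeros) (λ r → zeros ++ Q r) same r) (left r a′ b′))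
  b≡b′ : b ≡ b′
  b≡b′ = detectQ b b′ λ r →
    trans (sym (right r a b)) (trans (same-answers-++ʳ (λ r → P r ++ zeros) (λ r → zeros ++ Q r) same r) (right r a′ b′))

copies : ∀ t → Family n m → Family (t * n) (t * m)
copies zero Q ()
copies (suc t) Q = Q ⊕ copies t Q

copies-detecting : ∀ t {Q : Family n m} → Detecting Q → Detecting (copies t Q)
copies-detecting zero detect [] [] _ = refl
copies-detecting (suc t) detect = ⊕-detecting detect (copies-detecting t detect)

restrict : ∀ d e → Family (d + e) m → Family d m
restrict d e Q r = Vec.take d (Q r)

restrict-detecting : ∀ d e {Q : Family (d + e) m} → Detecting Q → Detecting (restrict d e Q)
restrict-detecting d e {Q} detect x y same =
  Vec.++-injectiveˡ x y (detect (x ++ zeros) (y ++ zeros) λ r → trans (padded r x) (trans (same r) (sym (padded r y))))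
  where
  padded : ∀ r x → Q r · (x ++ zeros) ≡ restrict d e Q r · x
  padded r x = begin
    Q r · (x ++ zeros)                                      ≡⟨ cong (_· (x ++ zeros)) (Vec.take++drop≡id d (Q r)) ⟨
    (Vec.take d (Q r) ++ Vec.drop d (Q r)) · (x ++ zeros)    ≡⟨ ·-++ (Vec.take d (Q r)) x (Vec.drop d (Q r)) zeros ⟩
    Vec.take d (Q r) · x + Vec.drop d (Q r) · zeros          ≡⟨ cong (Vec.take d (Q r) · x +_) (trans (·-comm (Vec.drop d (Q r)) zeros) (zeros· (Vec.drop d (Q r)))) ⟩
    Vec.take d (Q r) · x + 0                                 ≡⟨ +-identityʳ _ ⟩
    Vec.take d (Q r) · x                                     ∎
    where open ≡-Reasoning

detecting-family : ∀ d J t → d ≤ t * coordinates J → Σ (Family d (t * queries J)) Detecting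
detecting-family d J t d≤ = restrict d e Q , restrict-detecting d e detect
  where
  e = t * coordinates J ∸ d
  padded : Σ (Family (d + e) (t * queries J)) Detecting
  padded = subst (λ n → Σ (Family n (t * queries J)) Detecting) (sym (m+[n∸m]≡n d≤))
    (copies t (iterated J) , copies-detecting t (iterated-detecting J))
  Q = proj₁ padded
  detect = proj₂ padded

-- Counting argument for the lower bound

∑ : List A → (A → ℕ) → ℕ
∑ [] f = 0
∑ (x ∷ xs) f = f x + ∑ xs f

∑-++ : ∀ (xs ys : List A) f → ∑ (xs List.++ ys) f ≡ ∑ xs f + ∑ ys f
∑-++ [] ys f = refl
∑-++ (x ∷ xs) ys f = trans (cong (f x +_) (∑-++ xs ys f)) (sym (+-assoc (f x) _ _))

∑-map : ∀ {B : Set} (g : A → B) xs (f : B → ℕ) → ∑ (map g xs) f ≡ ∑ xs (f ∘ g)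
∑-map g [] f = refl
∑-map g (x ∷ xs) f = cong (f (g x) +_) (∑-map g xs f)

∑-cong : ∀ (xs : List A) {f g} → (∀ x → f x ≡ g x) → ∑ xs f ≡ ∑ xs g
∑-cong [] f≗g = refl
∑-cong (x ∷ xs) f≗g = cong₂ _+_ (f≗g x) (∑-cong xs f≗g)

∑-mono : ∀ (xs : List A) {f g} → (∀ x → f x ≤ g x) → ∑ xs f ≤ ∑ xs g
∑-mono [] f≤g = z≤n
∑-mono (x ∷ xs) f≤g = +-mono-≤ (f≤g x) (∑-mono xs f≤g)

∑-+ : ∀ (xs : List A) f g → ∑ xs (λ x → f x + g x) ≡ ∑ xs f + ∑ xs g
∑-+ [] f g = refl
∑-+ (x ∷ xs) f g = trans (cong (f x + g x +_) (∑-+ xs f g)) (rearrange (f x) (g x) _ _)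
  where rearrange : ∀ a b c d → (a + b) + (c + d) ≡ (a + c) + (b + d)
        rearrange = solve-∀

∑-*ˡ : ∀ (xs : List A) c f → ∑ xs (λ x → c * f x) ≡ c * ∑ xs f
∑-*ˡ [] c f = sym (*-zeroʳ c)
∑-*ˡ (x ∷ xs) c f = trans (cong (c * f x +_) (∑-*ˡ xs c f)) (sym (*-distribˡ-+ c (f x) _))

∑-const : ∀ (xs : List A) c → ∑ xs (λ _ → c) ≡ c * length xs
∑-const [] c = sym (*-zeroʳ c)
∑-const (x ∷ xs) c = trans (cong (c +_) (∑-const xs c)) (sym (*-suc c _))

∑-swap : ∀ {B : Set} (xs : List A) (ys : List B) (f : A → B → ℕ) → ∑ xs (λ x → ∑ ys (f x)) ≡ ∑ ys (λ y → ∑ xs (λ x → f x y))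
∑-swap [] ys f = sym (∑-const ys 0)
∑-swap (x ∷ xs) ys f = trans (cong (∑ ys (f x) +_) (∑-swap xs ys f)) (sym (∑-+ ys (f x) _))

vertices : ∀ d → List (Vertex d)
vertices zero = [] ∷ []
vertices (suc d) = map (false ∷_) (vertices d) List.++ map (true ∷_) (vertices d)

length-vertices : ∀ d → length (vertices d) ≡ 2 ^ d
length-vertices zero = refl
length-vertices (suc d) = begin
  length (map (false ∷_) (vertices d) List.++ map (true ∷_) (vertices d))  ≡⟨ List.length-++ (map (false ∷_) (vertices d)) ⟩
  length (map (false ∷_) (vertices d)) + length (map (true ∷_) (vertices d))
    ≡⟨ cong₂ _+_ (List.length-map (false ∷_) (vertices d)) (List.length-map (true ∷_) (vertices d)) ⟩
  length (vertices d) + length (vertices d)  ≡⟨ cong (λ n → n + n) (length-vertices d) ⟩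
  2 ^ d + 2 ^ d                              ≡⟨ cong (2 ^ d +_) (+-identityʳ (2 ^ d)) ⟨
  2 ^ suc d                                  ∎
  where open ≡-Reasoning

vertices-unique : ∀ d → Unique (vertices d)
vertices-unique zero = All.[] AllPairs.∷ AllPairs.[]
vertices-unique (suc d) =
  Unique.++⁺ (Unique.map⁺ Vec.∷-injectiveʳ (vertices-unique d)) (Unique.map⁺ Vec.∷-injectiveʳ (vertices-unique d)) disjoint
  where
  disjoint : ∀ {v} → v ∈ map (false ∷_) (vertices d) × v ∈ map (true ∷_) (vertices d) → ⊥
  disjoint (v∈₀ , v∈₁) with ∈-map⁻ (false ∷_) v∈₀ | ∈-map⁻ (true ∷_) v∈₁
  ... | _ , _ , refl | _ , _ , ()

∑-vertices-suc : ∀ d (f : Vertex (suc d) → ℕ) →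
                 ∑ (vertices (suc d)) f ≡ ∑ (vertices d) (λ x → f (false ∷ x) + f (true ∷ x))
∑-vertices-suc d f = begin
  ∑ (map (false ∷_) (vertices d) List.++ map (true ∷_) (vertices d)) f  ≡⟨ ∑-++ (map (false ∷_) (vertices d)) _ f ⟩
  ∑ (map (false ∷_) (vertices d)) f + ∑ (map (true ∷_) (vertices d)) f
    ≡⟨ cong₂ _+_ (∑-map (false ∷_) (vertices d) f) (∑-map (true ∷_) (vertices d) f) ⟩
  ∑ (vertices d) (λ x → f (false ∷ x)) + ∑ (vertices d) (λ x → f (true ∷ x))  ≡⟨ ∑-+ (vertices d) _ _ ⟨
  ∑ (vertices d) (λ x → f (false ∷ x) + f (true ∷ x))  ∎
  where open ≡-Reasoning

deviation : Vertex d → Vertex d → ℤ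
deviation {d} x s = ℤ.+ (2 * dist x s) ℤ.- ℤ.+ d

deviation² : Vertex d → Vertex d → ℕ
deviation² x s = ∣ deviation x s ∣ * ∣ deviation x s ∣

+∣i∣*∣i∣≡i*i : ∀ i → ℤ.+ (∣ i ∣ * ∣ i ∣) ≡ i ℤ.* i
+∣i∣*∣i∣≡i*i i with ℤ.+∣i∣≡i⊎+∣i∣≡-i i
... | inj₁ +∣i∣≡i = trans (ℤ.pos-* ∣ i ∣ ∣ i ∣) (cong₂ ℤ._*_ +∣i∣≡i +∣i∣≡i)
... | inj₂ +∣i∣≡-i = trans (ℤ.pos-* ∣ i ∣ ∣ i ∣) (trans (cong₂ ℤ._*_ +∣i∣≡-i +∣i∣≡-i) (neg*neg i))
  where neg*neg : ∀ i → (ℤ.- i) ℤ.* (ℤ.- i) ≡ i ℤ.* i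
        neg*neg = ℤ.solve-∀

∣i-1∣²+∣i+1∣² : ∀ i → ∣ i ℤ.- ℤ.1ℤ ∣ * ∣ i ℤ.- ℤ.1ℤ ∣ + ∣ i ℤ.+ ℤ.1ℤ ∣ * ∣ i ℤ.+ ℤ.1ℤ ∣ ≡ 2 * (∣ i ∣ * ∣ i ∣) + 2
∣i-1∣²+∣i+1∣² i = ℤ.+-injective (begin
  ℤ.+ (∣ i ℤ.- ℤ.1ℤ ∣ * ∣ i ℤ.- ℤ.1ℤ ∣ + ∣ i ℤ.+ ℤ.1ℤ ∣ * ∣ i ℤ.+ ℤ.1ℤ ∣)
    ≡⟨ cong₂ ℤ._+_ (+∣i∣*∣i∣≡i*i (i ℤ.- ℤ.1ℤ)) (+∣i∣*∣i∣≡i*i (i ℤ.+ ℤ.1ℤ)) ⟩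
  (i ℤ.- ℤ.1ℤ) ℤ.* (i ℤ.- ℤ.1ℤ) ℤ.+ (i ℤ.+ ℤ.1ℤ) ℤ.* (i ℤ.+ ℤ.1ℤ)  ≡⟨ expand i ⟩
  ℤ.+ 2 ℤ.* (i ℤ.* i) ℤ.+ ℤ.+ 2                                      ≡⟨ cong (λ j → ℤ.+ 2 ℤ.* j ℤ.+ ℤ.+ 2) (+∣i∣*∣i∣≡i*i i) ⟨
  ℤ.+ 2 ℤ.* ℤ.+ (∣ i ∣ * ∣ i ∣) ℤ.+ ℤ.+ 2                            ≡⟨ cong (ℤ._+ ℤ.+ 2) (ℤ.pos-* 2 (∣ i ∣ * ∣ i ∣)) ⟨
  ℤ.+ (2 * (∣ i ∣ * ∣ i ∣) + 2)                                      ∎)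
  where
  open ≡-Reasoning
  expand : ∀ i → (i ℤ.- ℤ.1ℤ) ℤ.* (i ℤ.- ℤ.1ℤ) ℤ.+ (i ℤ.+ ℤ.1ℤ) ℤ.* (i ℤ.+ ℤ.1ℤ) ≡ ℤ.+ 2 ℤ.* (i ℤ.* i) ℤ.+ ℤ.+ 2
  expand = ℤ.solve-∀

dist-∷-agree : ∀ b (x s : Vertex d) → dist (b ∷ x) (b ∷ s) ≡ dist x s
dist-∷-agree false x s = refl
dist-∷-agree true x s = refl

dist-∷-disagree : ∀ b (x s : Vertex d) → dist (not b ∷ x) (b ∷ s) ≡ suc (dist x s)
dist-∷-disagree false x s = refl
dist-∷-disagree true x s = refl

deviation-agree : ∀ b (x s : Vertex d) → deviation (b ∷ x) (b ∷ s) ≡ deviation x s ℤ.- ℤ.1ℤ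
deviation-agree {d} b x s = begin
  ℤ.+ (2 * dist (b ∷ x) (b ∷ s)) ℤ.- ℤ.+ suc d  ≡⟨ cong (λ D → ℤ.+ (2 * D) ℤ.- ℤ.+ suc d) (dist-∷-agree b x s) ⟩
  ℤ.+ (2 * dist x s) ℤ.- (ℤ.1ℤ ℤ.+ ℤ.+ d)        ≡⟨ shift (ℤ.+ (2 * dist x s)) (ℤ.+ d) ⟩
  deviation x s ℤ.- ℤ.1ℤ                         ∎
  where
  open ≡-Reasoning
  shift : ∀ D n → D ℤ.- (ℤ.1ℤ ℤ.+ n) ≡ (D ℤ.- n) ℤ.- ℤ.1ℤ
  shift = ℤ.solve-∀

deviation-disagree : ∀ b (x s : Vertex d) → deviation (not b ∷ x) (b ∷ s) ≡ deviation x s ℤ.+ ℤ.1ℤ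
deviation-disagree {d} b x s = begin
  ℤ.+ (2 * dist (not b ∷ x) (b ∷ s)) ℤ.- ℤ.+ suc d     ≡⟨ cong (λ D → ℤ.+ (2 * D) ℤ.- ℤ.+ suc d) (dist-∷-disagree b x s) ⟩
  ℤ.+ (2 * suc (dist x s)) ℤ.- ℤ.+ suc d               ≡⟨ cong (ℤ._- ℤ.+ suc d) (ℤ.pos-* 2 (suc (dist x s))) ⟩
  ℤ.+ 2 ℤ.* (ℤ.1ℤ ℤ.+ ℤ.+ dist x s) ℤ.- (ℤ.1ℤ ℤ.+ ℤ.+ d)  ≡⟨ shift (ℤ.+ dist x s) (ℤ.+ d) ⟩
  ℤ.+ 2 ℤ.* ℤ.+ dist x s ℤ.- ℤ.+ d ℤ.+ ℤ.1ℤ            ≡⟨ cong (λ D → D ℤ.- ℤ.+ d ℤ.+ ℤ.1ℤ) (ℤ.pos-* 2 (dist x s)) ⟨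
  deviation x s ℤ.+ ℤ.1ℤ                               ∎
  where
  open ≡-Reasoning
  shift : ∀ D n → ℤ.+ 2 ℤ.* (ℤ.1ℤ ℤ.+ D) ℤ.- (ℤ.1ℤ ℤ.+ n) ≡ ℤ.+ 2 ℤ.* D ℤ.- n ℤ.+ ℤ.1ℤ
  shift = ℤ.solve-∀

deviation²-pair : ∀ b (x s : Vertex d) →
                  deviation² (false ∷ x) (b ∷ s) + deviation² (true ∷ x) (b ∷ s) ≡ 2 * deviation² x s + 2
deviation²-pair false x s = begin
  deviation² (false ∷ x) (false ∷ s) + deviation² (not false ∷ x) (false ∷ s)
    ≡⟨ cong₂ (λ i j → ∣ i ∣ * ∣ i ∣ + ∣ j ∣ * ∣ j ∣) (deviation-agree false x s) (deviation-disagree false x s) ⟩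
  ∣ deviation x s ℤ.- ℤ.1ℤ ∣ * ∣ deviation x s ℤ.- ℤ.1ℤ ∣ + ∣ deviation x s ℤ.+ ℤ.1ℤ ∣ * ∣ deviation x s ℤ.+ ℤ.1ℤ ∣
    ≡⟨ ∣i-1∣²+∣i+1∣² (deviation x s) ⟩
  2 * deviation² x s + 2  ∎
  where open ≡-Reasoning
deviation²-pair true x s = begin
  deviation² (not true ∷ x) (true ∷ s) + deviation² (true ∷ x) (true ∷ s)
    ≡⟨ +-comm (deviation² (not true ∷ x) (true ∷ s)) _ ⟩
  deviation² (true ∷ x) (true ∷ s) + deviation² (not true ∷ x) (true ∷ s)
    ≡⟨ cong₂ (λ i j → ∣ i ∣ * ∣ i ∣ + ∣ j ∣ * ∣ j ∣) (deviation-agree true x s) (deviation-disagree true x s) ⟩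
  ∣ deviation x s ℤ.- ℤ.1ℤ ∣ * ∣ deviation x s ℤ.- ℤ.1ℤ ∣ + ∣ deviation x s ℤ.+ ℤ.1ℤ ∣ * ∣ deviation x s ℤ.+ ℤ.1ℤ ∣
    ≡⟨ ∣i-1∣²+∣i+1∣² (deviation x s) ⟩
  2 * deviation² x s + 2  ∎
  where open ≡-Reasoning

∑-deviation² : ∀ d (s : Vertex d) → ∑ (vertices d) (λ x → deviation² x s) ≡ d * 2 ^ d
∑-deviation² zero [] = refl
∑-deviation² (suc d) (b ∷ s) = begin
  ∑ (vertices (suc d)) (λ x → deviation² x (b ∷ s))                      ≡⟨ ∑-vertices-suc d _ ⟩
  ∑ (vertices d) (λ x → deviation² (false ∷ x) (b ∷ s) + deviation² (true ∷ x) (b ∷ s))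
    ≡⟨ ∑-cong (vertices d) (λ x → deviation²-pair b x s) ⟩
  ∑ (vertices d) (λ x → 2 * deviation² x s + 2)                           ≡⟨ ∑-+ (vertices d) _ _ ⟩
  ∑ (vertices d) (λ x → 2 * deviation² x s) + ∑ (vertices d) (λ _ → 2)
    ≡⟨ cong₂ _+_ (∑-*ˡ (vertices d) 2 _) (∑-const (vertices d) 2) ⟩
  2 * ∑ (vertices d) (λ x → deviation² x s) + 2 * length (vertices d)
    ≡⟨ cong₂ (λ a b → 2 * a + 2 * b) (∑-deviation² d s) (length-vertices d) ⟩
  2 * (d * 2 ^ d) + 2 * 2 ^ d                                             ≡⟨ collect d (2 ^ d) ⟩
  suc d * 2 ^ suc d                                                       ∎
  where
  open ≡-Reasoning
  collect : ∀ d P → 2 * (d * P) + 2 * P ≡ suc d * (2 * P)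
  collect = solve-∀

markov : ∀ (t : A → ℕ) c xs → length xs * suc c ≤ length (filter (λ x → t x ≤? c) xs) * suc c + ∑ xs t
markov t c [] = z≤n
markov t c (x ∷ xs) with t x ≤? c
... | yes tx≤c = begin
  suc c + length xs * suc c           ≤⟨ +-monoʳ-≤ (suc c) (markov t c xs) ⟩
  suc c + (G * suc c + ∑ xs t)        ≡⟨ +-assoc (suc c) (G * suc c) (∑ xs t) ⟨
  suc c + G * suc c + ∑ xs t          ≤⟨ +-monoʳ-≤ (suc c + G * suc c) (m≤n+m (∑ xs t) (t x)) ⟩
  suc c + G * suc c + (t x + ∑ xs t)  ≡⟨ cong (λ ys → length ys * suc c + (t x + ∑ xs t)) (List.filter-accept good? tx≤c) ⟨
  G′ * suc c + (t x + ∑ xs t)         ∎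
  where
  open ≤-Reasoning
  good? = λ x → t x ≤? c
  G = length (filter good? xs)
  G′ = length (filter good? (x ∷ xs))
... | no tx≰c = begin
  suc c + length xs * suc c           ≤⟨ +-mono-≤ (≰⇒> tx≰c) (markov t c xs) ⟩
  t x + (G * suc c + ∑ xs t)          ≡⟨ rearrange (t x) (G * suc c) (∑ xs t) ⟩
  G * suc c + (t x + ∑ xs t)          ≡⟨ cong (λ ys → length ys * suc c + (t x + ∑ xs t)) (List.filter-reject good? tx≰c) ⟨
  G′ * suc c + (t x + ∑ xs t)         ∎
  where
  open ≤-Reasoning
  good? = λ x → t x ≤? c
  G = length (filter good? xs)
  G′ = length (filter good? (x ∷ xs))
  rearrange : ∀ a b e → a + (b + e) ≡ b + (a + e)
  rearrange = solve-∀

at-least-half : ∀ L G X → L * suc (2 * X) ≤ G * suc (2 * X) + X * L → L ≤ 2 * G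
at-least-half L G X markov-bound = *-cancelʳ-≤ L (2 * G) (suc X) (begin
  L * suc X                ≤⟨ +-cancelʳ-≤ (X * L) _ _ (begin
    L * suc X + X * L        ≡⟨ split L X ⟩
    L * suc (2 * X)          ≤⟨ markov-bound ⟩
    G * suc (2 * X) + X * L  ∎) ⟩
  G * suc (2 * X)          ≤⟨ *-monoʳ-≤ G (n≤1+n (suc (2 * X))) ⟩
  G * (2 + 2 * X)          ≡⟨ regroup G X ⟩
  2 * G * suc X            ∎)
  where
  open ≤-Reasoning
  split : ∀ L X → L * suc X + X * L ≡ L * suc (2 * X)
  split = solve-∀
  regroup : ∀ G X → G * (2 + 2 * X) ≡ 2 * G * suc X
  regroup = solve-∀

∈-─ : ∀ {x z : A} {ys} (x∈ys : x ∈ ys) → z ∈ ys → z ≢ x → z ∈ ys ─ x∈ys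
∈-─ (here refl) (here refl) z≢x = ⊥-elim (z≢x refl)
∈-─ (here _) (there z∈ys) _ = z∈ys
∈-─ (there _) (here refl) _ = here refl
∈-─ (there x∈ys) (there z∈ys) z≢x = there (∈-─ x∈ys z∈ys z≢x)

unique⇒length≤ : ∀ {xs ys : List A} → Unique xs → (∀ {x} → x ∈ xs → x ∈ ys) → length xs ≤ length ys
unique⇒length≤ {xs = []} _ _ = z≤n
unique⇒length≤ {xs = x ∷ xs} {ys} (x∉xs AllPairs.∷ unique) xs⊆ys = begin
  suc (length xs)            ≤⟨ s≤s (unique⇒length≤ unique λ z∈xs → ∈-─ x∈ys (xs⊆ys (there z∈xs)) (All.lookup x∉xs z∈xs ∘ sym)) ⟩
  suc (length (ys ─ x∈ys))   ≡⟨ List.length-removeAt′ ys (Any.index x∈ys) ⟨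
  length ys                  ∎
  where
  open ≤-Reasoning
  x∈ys = xs⊆ys (here refl)

Entry : Set
Entry = ℕ × ℕ × Sign

quotientSum : List Entry → ℕ
quotientSum [] = 0
quotientSum ((q , _ , _) ∷ l) = q + quotientSum l

zeroHeaded : ℕ → List (List Entry) → List (List Entry)
zeroHeaded zero L = []
zeroHeaded (suc r) L = map ((0 , r , Sign.+) ∷_) L List.++ (map ((0 , r , Sign.-) ∷_) L List.++ zeroHeaded r L)

length-zeroHeaded : ∀ u L → length (zeroHeaded u L) ≡ u * (2 * length L)
length-zeroHeaded zero L = refl
length-zeroHeaded (suc r) L = begin
  length (map ((0 , r , Sign.+) ∷_) L List.++ (map ((0 , r , Sign.-) ∷_) L List.++ zeroHeaded r L))
    ≡⟨ List.length-++ (map ((0 , r , Sign.+) ∷_) L) ⟩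
  length (map ((0 , r , Sign.+) ∷_) L) + length (map ((0 , r , Sign.-) ∷_) L List.++ zeroHeaded r L)
    ≡⟨ cong₂ _+_ (List.length-map _ L) (List.length-++ (map ((0 , r , Sign.-) ∷_) L)) ⟩
  length L + (length (map ((0 , r , Sign.-) ∷_) L) + length (zeroHeaded r L))
    ≡⟨ cong₂ (λ a b → length L + (a + b)) (List.length-map _ L) (length-zeroHeaded r L) ⟩
  length L + (length L + r * (2 * length L))  ≡⟨ collect (length L) r ⟩
  suc r * (2 * length L)                      ∎
  where
  open ≡-Reasoning
  collect : ∀ a r → a + (a + r * (2 * a)) ≡ suc r * (2 * a)
  collect = solve-∀

∈-zeroHeaded : ∀ {u r σ l L} → r < u → l ∈ L → ((0 , r , σ) ∷ l) ∈ zeroHeaded u L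
∈-zeroHeaded {suc u} {r} {σ} {l} {L} r<1+u l∈L with m≤n⇒m<n∨m≡n (s≤s⁻¹ r<1+u)
... | inj₁ r<u = ∈-++⁺ʳ (map ((0 , u , Sign.+) ∷_) L) (∈-++⁺ʳ (map ((0 , u , Sign.-) ∷_) L) (∈-zeroHeaded r<u l∈L))
... | inj₂ refl with σ
...   | Sign.+ = ∈-++⁺ˡ (∈-map⁺ _ l∈L)
...   | Sign.- = ∈-++⁺ʳ (map ((0 , u , Sign.+) ∷_) L) (∈-++⁺ˡ (∈-map⁺ _ l∈L))

incrementHead : List Entry → List Entry
incrementHead [] = []
incrementHead ((q , r , σ) ∷ l) = (suc q , r , σ) ∷ l

-- codes u k B lists every length-k list of entries with remainders below u and quotient sum at most B:
-- those with a positive head quotient arise by incrementHead from budget B − 1.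
codes : ℕ → ℕ → ℕ → List (List Entry)
codes u zero B = [] ∷ []
codes u (suc k) zero = zeroHeaded u (codes u k zero)
codes u (suc k) (suc B) = zeroHeaded u (codes u k (suc B)) List.++ map incrementHead (codes u (suc k) B)

length-codes : ∀ u k B → length (codes u k B) ≤ 2 ^ k * 2 ^ B * (2 * u) ^ k
length-codes u zero B = subst (1 ≤_) (sym (trans (*-identityʳ _) (+-identityʳ (2 ^ B)))) (m^n>0 2 B)
length-codes u (suc k) zero = begin
  length (zeroHeaded u (codes u k zero))        ≡⟨ length-zeroHeaded u (codes u k zero) ⟩
  u * (2 * length (codes u k zero))             ≤⟨ *-monoʳ-≤ u (*-monoʳ-≤ 2 (length-codes u k zero)) ⟩
  u * (2 * (2 ^ k * 1 * (2 * u) ^ k))           ≤⟨ m≤m+n _ _ ⟩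
  u * (2 * (2 ^ k * 1 * (2 * u) ^ k)) + u * (2 * (2 ^ k * 1 * (2 * u) ^ k))  ≡⟨ collect u (2 ^ k) ((2 * u) ^ k) ⟩
  2 * 2 ^ k * 1 * ((2 * u) * (2 * u) ^ k)       ∎
  where
  open ≤-Reasoning
  collect : ∀ u P Q → u * (2 * (P * 1 * Q)) + u * (2 * (P * 1 * Q)) ≡ 2 * P * 1 * ((2 * u) * Q)
  collect = solve-∀
length-codes u (suc k) (suc B) = begin
  length (zeroHeaded u (codes u k (suc B)) List.++ map incrementHead (codes u (suc k) B))
    ≡⟨ List.length-++ (zeroHeaded u (codes u k (suc B))) ⟩
  length (zeroHeaded u (codes u k (suc B))) + length (map incrementHead (codes u (suc k) B))
    ≡⟨ cong₂ _+_ (length-zeroHeaded u (codes u k (suc B))) (List.length-map incrementHead (codes u (suc k) B)) ⟩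
  u * (2 * length (codes u k (suc B))) + length (codes u (suc k) B)
    ≤⟨ +-mono-≤ (*-monoʳ-≤ u (*-monoʳ-≤ 2 (length-codes u k (suc B)))) (length-codes u (suc k) B) ⟩
  u * (2 * (2 ^ k * (2 * 2 ^ B) * (2 * u) ^ k)) + 2 * 2 ^ k * 2 ^ B * ((2 * u) * (2 * u) ^ k)
    ≡⟨ collect u (2 ^ k) (2 ^ B) ((2 * u) ^ k) ⟩
  2 * 2 ^ k * (2 * 2 ^ B) * ((2 * u) * (2 * u) ^ k)  ∎
  where
  open ≤-Reasoning
  collect : ∀ u P R Q → u * (2 * (P * (2 * R) * Q)) + 2 * P * R * ((2 * u) * Q) ≡ 2 * P * (2 * R) * ((2 * u) * Q)
  collect = solve-∀

∈-codes : ∀ {u} l B → All (λ e → proj₁ (proj₂ e) < u) l → quotientSum l ≤ B → l ∈ codes u (length l) B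
∈-codes [] B _ _ = here refl
∈-codes ((zero , r , σ) ∷ l) zero (r<u All.∷ rs<u) Σq≤B = ∈-zeroHeaded r<u (∈-codes l zero rs<u Σq≤B)
∈-codes ((zero , r , σ) ∷ l) (suc B) (r<u All.∷ rs<u) Σq≤B = ∈-++⁺ˡ (∈-zeroHeaded r<u (∈-codes l (suc B) rs<u Σq≤B))
∈-codes {u} ((suc q , r , σ) ∷ l) (suc B) (r<u All.∷ rs<u) (s≤s Σq≤B) =
  ∈-++⁺ʳ (zeroHeaded u (codes u (length l) (suc B))) (∈-map⁺ incrementHead (∈-codes ((q , r , σ) ∷ l) B (r<u All.∷ rs<u) Σq≤B))

2mn≤m²+n² : ∀ m n → 2 * m * n ≤ m * m + n * n
2mn≤m²+n² m n = [ ordered m n , (λ n≤m → subst₂ _≤_ (swap n m) (+-comm (n * n) (m * m)) (ordered n m n≤m)) ]′ (≤-total m n)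
  where
  ordered : ∀ m n → m ≤ n → 2 * m * n ≤ m * m + n * n
  ordered m n m≤n = subst (λ n → 2 * m * n ≤ m * m + n * n) (m+[n∸m]≡n m≤n)
    (subst (2 * m * (m + (n ∸ m)) ≤_) (square-gap m (n ∸ m)) (m≤m+n _ _))
    where square-gap : ∀ m k → 2 * m * (m + k) + k * k ≡ m * m + (m + k) * (m + k)
          square-gap = solve-∀
  swap : ∀ n m → 2 * n * m ≡ 2 * m * n
  swap = solve-∀

module _ {d} {S : List (Vertex d)} (resolving : MetricGenerator d S)
         (u : ℕ) .{{_ : NonZero u}} (d≤u² : d ≤ u * u) where

  private
    k = length S

  -- Recording |deviation| in base u keeps the quotients small for vertices of low energy.
  entry : Vertex d → Vertex d → Entry
  entry x s = ∣ deviation x s ∣ / u , ∣ deviation x s ∣ % u , ℤ.sign (deviation x s)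

  code : Vertex d → List Entry
  code x = map (entry x) S

  entry⇒dist : ∀ {x y} s → entry x s ≡ entry y s → dist x s ≡ dist y s
  entry⇒dist {x} {y} s same = *-cancelˡ-≡ _ _ 2 (ℤ.+-injective (begin
    ℤ.+ (2 * dist x s)         ≡⟨ recentre (ℤ.+ (2 * dist x s)) (ℤ.+ d) ⟩
    deviation x s ℤ.+ ℤ.+ d    ≡⟨ cong (ℤ._+ ℤ.+ d) (ℤ.◃-cong (cong (proj₂ ∘ proj₂) same) ∣dev∣-same) ⟩
    deviation y s ℤ.+ ℤ.+ d    ≡⟨ recentre (ℤ.+ (2 * dist y s)) (ℤ.+ d) ⟨
    ℤ.+ (2 * dist y s)         ∎))
    where
    open ≡-Reasoning
    recentre : ∀ D n → D ≡ (D ℤ.- n) ℤ.+ n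
    recentre = ℤ.solve-∀
    ∣dev∣-same : ∣ deviation x s ∣ ≡ ∣ deviation y s ∣
    ∣dev∣-same = begin
      ∣ deviation x s ∣                                          ≡⟨ m≡m%n+[m/n]*n _ u ⟩
      ∣ deviation x s ∣ % u + ∣ deviation x s ∣ / u * u         ≡⟨ cong₂ (λ r q → r + q * u) (cong (proj₁ ∘ proj₂) same) (cong proj₁ same) ⟩
      ∣ deviation y s ∣ % u + ∣ deviation y s ∣ / u * u         ≡⟨ m≡m%n+[m/n]*n _ u ⟨
      ∣ deviation y s ∣                                          ∎

  code-injective : ∀ x y → code x ≡ code y → x ≡ y
  code-injective x y same = resolves⁻ (Vec.≡-dec Bool._≟_) resolving x y (agreement S same)
    where
    agreement : ∀ S′ → map (entry x) S′ ≡ map (entry y) S′ → Agree dist S′ x y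
    agreement [] _ = All.[]
    agreement (s ∷ S′) same = entry⇒dist {x} {y} s (List.∷-injectiveˡ same) All.∷ agreement S′ (List.∷-injectiveʳ same)

  energy : Vertex d → ℕ
  energy x = ∑ S (deviation² x)

  ∑-energy : ∑ (vertices d) energy ≡ (k * d) * 2 ^ d
  ∑-energy = begin
    ∑ (vertices d) (λ x → ∑ S (deviation² x))   ≡⟨ ∑-swap (vertices d) S deviation² ⟩
    ∑ S (λ s → ∑ (vertices d) (λ x → deviation² x s)) ≡⟨ ∑-cong S (∑-deviation² d) ⟩
    ∑ S (λ _ → d * 2 ^ d)                       ≡⟨ ∑-const S (d * 2 ^ d) ⟩
    d * 2 ^ d * k                               ≡⟨ regroup d (2 ^ d) k ⟩
    k * d * 2 ^ d                               ∎
    where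
    open ≡-Reasoning
    regroup : ∀ d P k → d * P * k ≡ k * d * P
    regroup = solve-∀

  good : List (Vertex d)
  good = filter (λ x → energy x ≤? 2 * (k * d)) (vertices d)

  many-good : 2 ^ d ≤ 2 * length good
  many-good = at-least-half (2 ^ d) (length good) (k * d)
    (subst₂ (λ L Σ → L * suc (2 * (k * d)) ≤ length good * suc (2 * (k * d)) + Σ)
            (length-vertices d) ∑-energy (markov energy (2 * (k * d)) (vertices d)))

  low-energy⇒small-quotients : ∀ x → energy x ≤ 2 * (k * d) → ∑ S (λ s → ∣ deviation x s ∣ / u) ≤ 2 * k
  low-energy⇒small-quotients x low = *-cancelˡ-≤ 2 (≤-trans 2C≤3k (≤-trans (m≤m+n (3 * k) k) (≤-reflexive (3k+k≡4k k))))
    where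
    open ≤-Reasoning
    3k+k≡4k : ∀ k → 3 * k + k ≡ 2 * (2 * k)
    3k+k≡4k = solve-∀
    a : Vertex d → ℕ
    a s = ∣ deviation x s ∣
    2uA≤3ku² : 2 * u * ∑ S a ≤ 3 * k * (u * u)
    2uA≤3ku² = begin
      2 * u * ∑ S a                     ≡⟨ ∑-*ˡ S (2 * u) a ⟨
      ∑ S (λ s → 2 * u * a s)           ≤⟨ ∑-mono S (λ s → 2mn≤m²+n² u (a s)) ⟩
      ∑ S (λ s → u * u + a s * a s)     ≡⟨ ∑-+ S (λ _ → u * u) (λ s → a s * a s) ⟩
      ∑ S (λ _ → u * u) + energy x      ≡⟨ cong (_+ energy x) (∑-const S (u * u)) ⟩
      u * u * k + energy x              ≤⟨ +-monoʳ-≤ (u * u * k) (≤-trans low (*-monoʳ-≤ 2 (*-monoʳ-≤ k d≤u²))) ⟩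
      u * u * k + 2 * (k * (u * u))     ≡⟨ collect k (u * u) ⟩
      3 * k * (u * u)                   ∎
      where collect : ∀ k U → U * k + 2 * (k * U) ≡ 3 * k * U
            collect = solve-∀
    2C≤3k : 2 * ∑ S (λ s → a s / u) ≤ 3 * k
    2C≤3k = *-cancelʳ-≤ _ _ (u * u) ⦃ m*n≢0 u u ⦄ (begin
      2 * ∑ S (λ s → a s / u) * (u * u)       ≡⟨ regroup (∑ S (λ s → a s / u)) u ⟩
      2 * u * (∑ S (λ s → a s / u) * u)       ≡⟨ cong (λ z → 2 * u * z) (trans (*-comm _ u) (sym (∑-*ˡ S u (λ s → a s / u)))) ⟩
      2 * u * ∑ S (λ s → u * (a s / u))       ≤⟨ *-monoʳ-≤ (2 * u) (∑-mono S (λ s → subst (_≤ a s) (*-comm (a s / u) u) (m/n*n≤m (a s) u))) ⟩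
      2 * u * ∑ S a                           ≤⟨ 2uA≤3ku² ⟩
      3 * k * (u * u)                         ∎)
      where regroup : ∀ C u → 2 * C * (u * u) ≡ 2 * u * (C * u)
            regroup = solve-∀

  quotientSum-code : ∀ x S′ → quotientSum (map (entry x) S′) ≡ ∑ S′ (λ s → ∣ deviation x s ∣ / u)
  quotientSum-code x [] = refl
  quotientSum-code x (s ∷ S′) = cong (∣ deviation x s ∣ / u +_) (quotientSum-code x S′)

  code∈codes : ∀ {x} → x ∈ good → code x ∈ codes u k (2 * k)
  code∈codes {x} x∈good = subst (λ n → code x ∈ codes u n (2 * k)) (List.length-map (entry x) S)
    (∈-codes (code x) (2 * k) (All.map⁺ (All.universal (λ s → m%n<n ∣ deviation x s ∣ u) S))
      (subst (_≤ 2 * k) (sym (quotientSum-code x S))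
        (low-energy⇒small-quotients x (proj₂ (∈-filter⁻ (λ x → energy x ≤? 2 * (k * d)) {xs = vertices d} x∈good)))))

  metric-generator-count : 2 ^ d ≤ 2 * (2 ^ k * 2 ^ (2 * k) * (2 * u) ^ k)
  metric-generator-count = ≤-trans many-good (*-monoʳ-≤ 2 (begin
    length good              ≡⟨ List.length-map code good ⟨
    length (map code good)   ≤⟨ unique⇒length≤ (Unique.map⁺ (code-injective _ _) (Unique.filter⁺ _ (vertices-unique d))) codes⊇ ⟩
    length (codes u k (2 * k))  ≤⟨ length-codes u k (2 * k) ⟩
    2 ^ k * 2 ^ (2 * k) * (2 * u) ^ k  ∎))
    where
    open ≤-Reasoning
    codes⊇ : ∀ {c} → c ∈ map code good → c ∈ codes u k (2 * k)
    codes⊇ c∈ with ∈-map⁻ code c∈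
    ... | x , x∈good , refl = code∈codes x∈good

-- Asymptotics

2^-cancel-≤ : ∀ {m n} → 2 ^ m ≤ 2 ^ n → m ≤ n
2^-cancel-≤ 2^m≤2^n = ≮⇒≥ λ n<m → <⇒≱ (^-monoʳ-< 2 (s≤s (s≤s z≤n)) n<m) 2^m≤2^n

2^-cancel-< : ∀ {m n} → 2 ^ m < 2 ^ n → m < n
2^-cancel-< 2^m<2^n = ≰⇒> λ n≤m → <⇒≱ 2^m<2^n (^-monoʳ-≤ 2 n≤m)

metric-generator-size : ∀ {d S} → MetricGenerator d S → ∀ h → d ≤ 2 ^ (2 * h) → d ≤ 1 + (h + 4) * length S
metric-generator-size {d} {S} resolving h d≤4^h = 2^-cancel-≤ (begin
  2 ^ d                                          ≤⟨ metric-generator-count resolving (2 ^ h) ⦃ m^n≢0 2 h ⦄ d≤u² ⟩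
  2 * (2 ^ k * 2 ^ (2 * k) * (2 ^ suc h) ^ k)   ≡⟨ cong (λ z → 2 * (2 ^ k * 2 ^ (2 * k) * z)) (^-*-assoc 2 (suc h) k) ⟩
  2 ^ 1 * (2 ^ k * 2 ^ (2 * k) * 2 ^ (suc h * k)) ≡⟨ cong (λ z → 2 ^ 1 * (z * 2 ^ (suc h * k))) (^-distribˡ-+-* 2 k (2 * k)) ⟨
  2 ^ 1 * (2 ^ (k + 2 * k) * 2 ^ (suc h * k))   ≡⟨ cong (2 ^ 1 *_) (^-distribˡ-+-* 2 (k + 2 * k) (suc h * k)) ⟨
  2 ^ 1 * 2 ^ (k + 2 * k + suc h * k)            ≡⟨ ^-distribˡ-+-* 2 1 (k + 2 * k + suc h * k) ⟨
  2 ^ (1 + (k + 2 * k + suc h * k))              ≡⟨ cong (2 ^_) (collect k h) ⟩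
  2 ^ (1 + (h + 4) * k)                          ∎)
  where
  open ≤-Reasoning
  k = length S
  d≤u² : d ≤ 2 ^ h * 2 ^ h
  d≤u² = subst (d ≤_) (trans (cong (2 ^_) (cong (h +_) (+-identityʳ h))) (^-distribˡ-+-* 2 h h)) d≤4^h
  collect : ∀ k h → 1 + (k + 2 * k + suc h * k) ≡ 1 + (h + 4) * k
  collect = solve-∀

half-ceiling : ∀ ℓ → ∃ λ h → suc ℓ ≤ 2 * h × 2 * h ≤ 2 + ℓ
half-ceiling zero = 1 , s≤s z≤n , ≤-refl
half-ceiling (suc ℓ) with half-ceiling ℓ
... | h , lo , hi with suc (suc ℓ) ≤? 2 * h
...   | yes lo′ = h , lo′ , m≤n⇒m≤1+n hi
...   | no ¬lo′ = suc h , subst (suc (suc ℓ) ≤_) 2+2h≡ (m≤n⇒m≤1+n (s≤s lo)) ,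
                 subst (_≤ 2 + suc ℓ) 2+2h≡ (s≤s (s≤s (≤-pred (≰⇒> ¬lo′))))
  where 2+2h≡ : 2 + 2 * h ≡ 2 * suc h
        2+2h≡ = sym (*-suc 2 h)

metric-generator-lower-bound : ∀ {d S} → MetricGenerator d S → ∀ ℓ → d < 2 ^ suc ℓ → 2 * d ≤ 2 + (ℓ + 10) * length S
metric-generator-lower-bound {d} {S} resolving ℓ d<2^ℓ+1 = begin
  2 * d                       ≤⟨ *-monoʳ-≤ 2 (metric-generator-size resolving h d≤4^h) ⟩
  2 * (1 + (h + 4) * k)       ≡⟨ expand h k ⟩
  2 + (2 * h + 8) * k         ≤⟨ +-monoʳ-≤ 2 (*-monoˡ-≤ k (≤-trans (+-monoˡ-≤ 8 2h≤2+ℓ) (≤-reflexive (shift ℓ)))) ⟩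
  2 + (ℓ + 10) * k            ∎
  where
  open ≤-Reasoning
  k = length S
  h = proj₁ (half-ceiling ℓ)
  1+ℓ≤2h = proj₁ (proj₂ (half-ceiling ℓ))
  2h≤2+ℓ = proj₂ (proj₂ (half-ceiling ℓ))
  d≤4^h : d ≤ 2 ^ (2 * h)
  d≤4^h = ≤-trans (<⇒≤ d<2^ℓ+1) (^-monoʳ-≤ 2 1+ℓ≤2h)
  expand : ∀ h k → 2 * (1 + (h + 4) * k) ≡ 2 + (2 * h + 8) * k
  expand = solve-∀
  shift : ∀ ℓ → 2 + ℓ + 8 ≡ ℓ + 10
  shift = solve-∀

edge-metric-generator-lower-bound : ∀ {d S} → EdgeMetricGenerator d S → ∀ ℓ → d < 2 ^ suc ℓ → 2 * d ≤ 4 + (ℓ + 10) * length S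
edge-metric-generator-lower-bound {zero} _ ℓ _ = z≤n
edge-metric-generator-lower-bound {suc d} {S} resolving ℓ d<2^ℓ+1 = begin
  2 * suc d                                   ≡⟨ *-suc 2 d ⟩
  2 + 2 * d                                   ≤⟨ +-monoʳ-≤ 2 (metric-generator-lower-bound (edge⇒metric resolving) ℓ (<-trans (n<1+n d) d<2^ℓ+1)) ⟩
  2 + (2 + (ℓ + 10) * length (map Vec.tail S))  ≡⟨ cong (λ k → 4 + (ℓ + 10) * k) (List.length-map Vec.tail S) ⟩
  4 + (ℓ + 10) * length S                     ∎
  where open ≤-Reasoning

binary-length : ∀ d → 1 ≤ d → ∃ λ ℓ → 2 ^ ℓ ≤ d × d < 2 ^ suc ℓ
binary-length (suc zero) _ = 0 , ≤-refl , s≤s (s≤s z≤n)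
binary-length (suc (suc d)) _ with binary-length (suc d) (s≤s z≤n)
... | ℓ , lo , hi with suc (suc d) <? 2 ^ suc ℓ
...   | yes below = ℓ , m≤n⇒m≤1+n lo , below
...   | no ¬below = suc ℓ , ≤-reflexive (sym at-power) ,
                   subst (_< 2 ^ suc (suc ℓ)) (sym at-power) (^-monoʳ-< 2 (s≤s (s≤s z≤n)) (n<1+n (suc ℓ)))
  where at-power : suc (suc d) ≡ 2 ^ suc ℓ
        at-power = ≤-antisym hi (≮⇒≥ ¬below)

[4+b]²≤2^[4+b] : ∀ b → (4 + b) * (4 + b) ≤ 2 ^ (4 + b)
[4+b]²≤2^[4+b] zero = ≤-refl
[4+b]²≤2^[4+b] (suc b) = begin
  (5 + b) * (5 + b)        ≤⟨ m≤m+n _ (7 + 6 * b + b * b) ⟩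
  (5 + b) * (5 + b) + (7 + 6 * b + b * b)  ≡⟨ double-square b ⟩
  2 * ((4 + b) * (4 + b))  ≤⟨ *-monoʳ-≤ 2 ([4+b]²≤2^[4+b] b) ⟩
  2 * 2 ^ (4 + b)          ∎
  where
  open ≤-Reasoning
  double-square : ∀ b → (5 + b) * (5 + b) + (7 + 6 * b + b * b) ≡ 2 * ((4 + b) * (4 + b))
  double-square = solve-∀

c*[a+1]≤2^a : ∀ c a → c + 4 ≤ a → c * (a + 1) ≤ 2 ^ a
c*[a+1]≤2^a c a c+4≤a = begin
  c * (a + 1)       ≡⟨ *-distribˡ-+ c a 1 ⟩
  c * a + c * 1     ≤⟨ +-monoʳ-≤ (c * a) (≤-trans (≤-reflexive (*-identityʳ c)) c≤a) ⟩
  c * a + a         ≡⟨ +-comm (c * a) a ⟩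
  suc c * a         ≤⟨ *-monoˡ-≤ a 1+c≤a ⟩
  a * a             ≡⟨ cong (λ n → n * n) a≡4+b ⟩
  (4 + b) * (4 + b) ≤⟨ [4+b]²≤2^[4+b] b ⟩
  2 ^ (4 + b)       ≡⟨ cong (2 ^_) a≡4+b ⟨
  2 ^ a             ∎
  where
  open ≤-Reasoning
  c≤a = ≤-trans (m≤m+n c 4) c+4≤a
  1+c≤a = ≤-trans (m≤m+n (suc c) 3) (≤-trans (≤-reflexive (sym (+-suc c 3))) c+4≤a)
  b = a ∸ 4
  a≡4+b : a ≡ 4 + b
  a≡4+b = sym (m+[n∸m]≡n (≤-trans (m≤n+m 4 c) c+4≤a))

lower-exponent : ∀ {d ℓ k q p} → 2 * d ≤ 4 + (ℓ + 10) * k → 14 * q ≤ ℓ → 1 ≤ k → 1 ≤ p →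
                 2 * d * (q ∸ p) ≤ ℓ * (q * k)
lower-exponent {d} {ℓ} {k} {q} {p} 2d≤ 14q≤ℓ 1≤k 1≤p with q ≤? p
... | yes q≤p = ≤-trans (≤-reflexive (trans (cong (2 * d *_) (m≤n⇒m∸n≡0 q≤p)) (*-zeroʳ (2 * d)))) z≤n
... | no q≰p = begin
  2 * d * r                              ≤⟨ *-monoˡ-≤ r 2d≤ ⟩
  (4 + (ℓ + 10) * k) * r                 ≡⟨ expand ℓ k r ⟩
  ℓ * k * r + (4 * r + 10 * k * r)       ≤⟨ +-monoʳ-≤ (ℓ * k * r) (+-monoˡ-≤ (10 * k * r) (*-monoˡ-≤ r (*-monoʳ-≤ 4 1≤k))) ⟩
  ℓ * k * r + (4 * k * r + 10 * k * r)   ≡⟨ cong (ℓ * k * r +_) (collect k r) ⟩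
  ℓ * k * r + 14 * r * k                 ≤⟨ +-monoʳ-≤ (ℓ * k * r) (*-monoˡ-≤ k (≤-trans (*-monoʳ-≤ 14 (m∸n≤m q p)) 14q≤ℓ)) ⟩
  ℓ * k * r + ℓ * k                      ≤⟨ +-monoʳ-≤ (ℓ * k * r) (m≤m*n (ℓ * k) p ⦃ >-nonZero 1≤p ⦄) ⟩
  ℓ * k * r + ℓ * k * p                  ≡⟨ factor ℓ k r p ⟩
  ℓ * ((p + r) * k)                      ≡⟨ cong (λ q → ℓ * (q * k)) (m+[n∸m]≡n (≤-trans (n≤1+n p) (≰⇒> q≰p))) ⟩
  ℓ * (q * k)                            ∎
  where
  open ≤-Reasoning
  r = q ∸ p
  expand : ∀ ℓ k r → (4 + (ℓ + 10) * k) * r ≡ ℓ * k * r + (4 * r + 10 * k * r)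
  expand = solve-∀
  collect : ∀ k r → 4 * k * r + 10 * k * r ≡ 14 * r * k
  collect = solve-∀
  factor : ∀ ℓ k r p → ℓ * k * r + ℓ * k * p ≡ ℓ * ((p + r) * k)
  factor = solve-∀

scaled-generator-size : ∀ {d J D} → D * coordinates J ≤ d → J * (2 + (D + 1) * queries J) ≤ 2 * d + J * (2 + 2 * 2 ^ J)
scaled-generator-size {d} {J} {D} Dn≤d = begin
  J * (2 + (D + 1) * M)                 ≡⟨ expand J D M ⟩
  J * D * M + J * (2 + M)               ≤⟨ +-mono-≤ (*-monoʳ-≤ (J * D) M≤2P) (*-monoʳ-≤ J (+-monoʳ-≤ 2 M≤2P)) ⟩
  J * D * (2 * P) + J * (2 + 2 * P)     ≡⟨ cong (_+ J * (2 + 2 * P)) (regroup J D P) ⟩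
  2 * (D * (J * P)) + J * (2 + 2 * P)   ≤⟨ +-monoˡ-≤ (J * (2 + 2 * P)) (*-monoʳ-≤ 2 (≤-trans (*-monoʳ-≤ D JP≤n) Dn≤d)) ⟩
  2 * d + J * (2 + 2 * P)               ∎
  where
  open ≤-Reasoning
  P = 2 ^ J
  M = queries J
  M≤2P : M ≤ 2 * P
  M≤2P = ≤-trans (n≤1+n M) (≤-reflexive (queries-closed J))
  JP≤n : J * P ≤ coordinates J
  JP≤n = subst (J * P ≤_) (sym (coordinates-closed J)) (m≤m+n (J * P) 1)
  expand : ∀ J D m → J * (2 + (D + 1) * m) ≡ J * D * m + J * (2 + m)
  expand = solve-∀
  regroup : ∀ J D P → J * D * (2 * P) ≡ 2 * (D * (J * P))
  regroup = solve-∀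

upper-exponent : ∀ {q p d ℓ J a D} → J + a ≡ ℓ → 1 ≤ q → 1 ≤ p →
                 D * coordinates J ≤ d → 2 ^ ℓ ≤ d → 2 * q * (a + 1) ≤ J → 4 * q * (ℓ + 1) ≤ 2 ^ a →
                 (ℓ + 1) * (q * (2 + (D + 1) * queries J)) ≤ 2 * d * (q + p)
upper-exponent {q} {p} {d} {_} {J} {a} {D} refl 1≤q 1≤p Dn≤d 2^ℓ≤d 2q[a+1]≤J 4q[ℓ+1]≤2^a =
  *-cancelˡ-≤ J ⦃ >-nonZero (≤-trans (s≤s z≤n) (≤-trans (*-mono-≤ (*-monoʳ-≤ 2 1≤q) (m≤n+m 1 a)) 2q[a+1]≤J)) ⦄ (begin
    J * (L * (q * X))                         ≡⟨ regroup J L q X ⟩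
    L * q * (J * X)                           ≤⟨ *-monoʳ-≤ (L * q) (scaled-generator-size {d} {J} {D} Dn≤d) ⟩
    L * q * (2 * d + J * (2 + 2 * P))         ≡⟨ expand J a q d (2 + 2 * P) ⟩
    J * q * (2 * d) + (a + 1) * q * (2 * d) + L * q * J * (2 + 2 * P)
      ≤⟨ +-mono-≤ (+-monoʳ-≤ (J * q * (2 * d)) overhead-a) overhead-P ⟩
    J * q * (2 * d) + d * J * p + J * d * p   ≡⟨ factor J q d p ⟩
    J * (2 * d * (q + p))                     ∎)
  where
  open ≤-Reasoning
  L = J + a + 1
  P = 2 ^ J
  X = 2 + (D + 1) * queries J
  overhead-a : (a + 1) * q * (2 * d) ≤ d * J * p
  overhead-a = begin
    (a + 1) * q * (2 * d)   ≡⟨ regroup-a a q d ⟩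
    d * (2 * q * (a + 1))   ≤⟨ *-monoʳ-≤ d 2q[a+1]≤J ⟩
    d * J                   ≤⟨ m≤m*n (d * J) p ⦃ >-nonZero 1≤p ⦄ ⟩
    d * J * p               ∎
    where
    regroup-a : ∀ a q d → (a + 1) * q * (2 * d) ≡ d * (2 * q * (a + 1))
    regroup-a = solve-∀
  overhead-P : L * q * J * (2 + 2 * P) ≤ J * d * p
  overhead-P = begin
    L * q * J * (2 + 2 * P)   ≤⟨ *-monoʳ-≤ (L * q * J) (≤-trans (+-monoˡ-≤ (2 * P) (*-monoʳ-≤ 2 (m^n>0 2 J))) (≤-reflexive (double P))) ⟩
    L * q * J * (4 * P)       ≡⟨ regroup-P L q J P ⟩
    J * P * (4 * q * L)       ≤⟨ *-monoʳ-≤ (J * P) 4q[ℓ+1]≤2^a ⟩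
    J * P * 2 ^ a             ≡⟨ *-assoc J P (2 ^ a) ⟩
    J * (P * 2 ^ a)           ≡⟨ cong (J *_) (^-distribˡ-+-* 2 J a) ⟨
    J * 2 ^ (J + a)           ≤⟨ *-monoʳ-≤ J 2^ℓ≤d ⟩
    J * d                     ≤⟨ m≤m*n (J * d) p ⦃ >-nonZero 1≤p ⦄ ⟩
    J * d * p                 ∎
    where
    double : ∀ P → 2 * P + 2 * P ≡ 4 * P
    double = solve-∀
    regroup-P : ∀ L q J P → L * q * J * (4 * P) ≡ J * P * (4 * q * L)
    regroup-P = solve-∀
  regroup : ∀ J L q X → J * (L * (q * X)) ≡ L * q * (J * X)
  regroup = solve-∀
  expand : ∀ J a q d R → (J + a + 1) * q * (2 * d + J * R) ≡ J * q * (2 * d) + (a + 1) * q * (2 * d) + (J + a + 1) * q * J * R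
  expand = solve-∀
  factor : ∀ J q d p → J * q * (2 * d) + d * J * p + J * d * p ≡ J * (2 * d * (q + p))
  factor = solve-∀

m<[m/n+1]*n : ∀ m n .{{_ : NonZero n}} → m < (m / n + 1) * n
m<[m/n+1]*n m n = begin-strict
  m                  ≡⟨ m≡m%n+[m/n]*n m n ⟩
  m % n + m / n * n  <⟨ +-monoˡ-< (m / n * n) (m%n<n m n) ⟩
  (1 + m / n) * n    ≡⟨ cong (_* n) (+-comm 1 (m / n)) ⟩
  (m / n + 1) * n    ∎
  where open ≤-Reasoning

2q[a+1]+a≤a*4q : ∀ q a → 1 ≤ q → 2 ≤ a → 2 * q * (a + 1) + a ≤ a * (4 * q)
2q[a+1]+a≤a*4q (suc q′) (suc (suc a′)) _ (s≤s (s≤s z≤n)) = ≤-trans (m≤m+n _ (a′ + 2 * q′ + 2 * q′ * a′)) (≤-reflexive (slack a′ q′))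
  where slack : ∀ a′ q′ → 2 * suc q′ * (suc (suc a′) + 1) + suc (suc a′) + (a′ + 2 * q′ + 2 * q′ * a′) ≡ suc (suc a′) * (4 * suc q′)
        slack = solve-∀

-- With a ≈ ℓ / 4q and blocks of J = ℓ − a doubling steps, the first bound makes (ℓ + 1) / J close to 1
-- and the second makes the 2^J queries of a single block negligible against d ≥ 2^ℓ.
split-exponent : ∀ q ℓ .{{_ : NonZero q}} → (16 * (q * q) + 4) * (4 * q) ≤ ℓ →
                 ∃ λ a → a ≤ ℓ × 2 * q * (a + 1) ≤ ℓ ∸ a × 4 * q * (ℓ + 1) ≤ 2 ^ a
split-exponent q@(suc q′) ℓ big = a , a≤ℓ , m+n≤o⇒m≤o∸n (2 * q * (a + 1)) 2q[a+1]+a≤ℓ , 4q[ℓ+1]≤2^a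
  where
  open ≤-Reasoning
  M = 4 * q
  c = 16 * (q * q)
  a = ℓ / M
  aM≤ℓ : a * M ≤ ℓ
  aM≤ℓ = m/n*n≤m ℓ M
  a≤ℓ : a ≤ ℓ
  a≤ℓ = ≤-trans (m≤m*n a M) aM≤ℓ
  c+4≤a : c + 4 ≤ a
  c+4≤a = subst (_≤ a) (m*n/n≡m (c + 4) M) (/-monoˡ-≤ M big)
  2q[a+1]+a≤ℓ : 2 * q * (a + 1) + a ≤ ℓ
  2q[a+1]+a≤ℓ = ≤-trans (2q[a+1]+a≤a*4q q a (s≤s z≤n) (≤-trans (m≤n+m 2 (c + 2)) (≤-trans (≤-reflexive (+-assoc c 2 2)) c+4≤a))) aM≤ℓ
  4q[ℓ+1]≤2^a : 4 * q * (ℓ + 1) ≤ 2 ^ a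
  4q[ℓ+1]≤2^a = begin
    4 * q * (ℓ + 1)        ≡⟨ cong (4 * q *_) (+-comm ℓ 1) ⟩
    4 * q * suc ℓ          ≤⟨ *-monoʳ-≤ (4 * q) (m<[m/n+1]*n ℓ M) ⟩
    4 * q * ((a + 1) * M)  ≡⟨ regroup q a ⟩
    c * (a + 1)            ≤⟨ c*[a+1]≤2^a c a c+4≤a ⟩
    2 ^ a                  ∎
    where regroup : ∀ q a → 4 * q * ((a + 1) * (4 * q)) ≡ 16 * (q * q) * (a + 1)
          regroup = solve-∀

coordinates-nonZero : ∀ J → NonZero (coordinates J)
coordinates-nonZero J = >-nonZero (subst (0 <_) (sym (coordinates-closed J)) (m≤n+m 1 (J * 2 ^ J)))

LowerBound UpperBound : (ℕ → ℕ) → Set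
LowerBound f = ∀ d ℓ → d < 2 ^ suc ℓ → 2 * d ≤ 4 + (ℓ + 10) * f d
UpperBound f = ∀ d J t → d ≤ t * coordinates J → f d ≤ 2 + t * queries J

upper-half : ∀ {f} → UpperBound f → ∀ q p d ℓ .{{_ : NonZero q}} → 1 ≤ p → 2 ^ ℓ ≤ d → d < 2 ^ suc ℓ →
             (16 * (q * q) + 4) * (4 * q) ≤ ℓ → d ^ (q * f d) ≤ 2 ^ (2 * d * (q + p))
upper-half {f} upper q p d ℓ 1≤p 2^ℓ≤d d<2^ℓ+1 big = with-split (split-exponent q ℓ big)
  where
  with-split : (∃ λ a → a ≤ ℓ × 2 * q * (a + 1) ≤ ℓ ∸ a × 4 * q * (ℓ + 1) ≤ 2 ^ a) → d ^ (q * f d) ≤ 2 ^ (2 * d * (q + p))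
  with-split (a , a≤ℓ , 2q[a+1]≤J , 4q[ℓ+1]≤2^a) = begin
    d ^ (q * f d)            ≤⟨ ^-monoʳ-≤ d ⦃ >-nonZero (≤-trans (m^n>0 2 ℓ) 2^ℓ≤d) ⦄ (*-monoʳ-≤ q f≤X) ⟩
    d ^ (q * X)              ≤⟨ ^-monoˡ-≤ (q * X) (<⇒≤ d<2^ℓ+1) ⟩
    (2 ^ suc ℓ) ^ (q * X)    ≡⟨ ^-*-assoc 2 (suc ℓ) (q * X) ⟩
    2 ^ (suc ℓ * (q * X))    ≡⟨ cong (λ e → 2 ^ (e * (q * X))) (+-comm 1 ℓ) ⟩
    2 ^ ((ℓ + 1) * (q * X))  ≤⟨ ^-monoʳ-≤ 2 (upper-exponent {q} {p} {d} {ℓ} {J} {a} {d / C} (m∸n+n≡m a≤ℓ) (>-nonZero⁻¹ q) 1≤p (m/n*n≤m d C) 2^ℓ≤d 2q[a+1]≤J 4q[ℓ+1]≤2^a) ⟩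
    2 ^ (2 * d * (q + p))    ∎
    where
    open ≤-Reasoning
    J = ℓ ∸ a
    C = coordinates J
    instance
      C≢0 : NonZero C
      C≢0 = coordinates-nonZero J
    X = 2 + (d / C + 1) * queries J
    f≤X : f d ≤ X
    f≤X = upper d J (d / C + 1) (<⇒≤ (m<[m/n+1]*n d C))

lower-bound⇒positive : ∀ {d c k} → 4 < 2 * d → 2 * d ≤ 4 + c * k → 1 ≤ k
lower-bound⇒positive {d} {c} {zero} 4<2d 2d≤4+c*0 = contradiction (subst (λ z → 2 * d ≤ 4 + z) (*-zeroʳ c) 2d≤4+c*0) (<⇒≱ 4<2d)
lower-bound⇒positive {k = suc _} _ _ = s≤s z≤n

lower-half : ∀ {f} → LowerBound f → ∀ q p d ℓ → 1 ≤ p → 4 ≤ d → 2 ^ ℓ ≤ d → d < 2 ^ suc ℓ → 14 * q ≤ ℓ →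
             2 ^ (2 * d * (q ∸ p)) ≤ d ^ (q * f d)
lower-half {f} lower q p d ℓ 1≤p 4≤d 2^ℓ≤d d<2^ℓ+1 14q≤ℓ = begin
  2 ^ (2 * d * (q ∸ p))   ≤⟨ ^-monoʳ-≤ 2 (lower-exponent {d} {ℓ} {f d} {q} {p} 2d≤ 14q≤ℓ (lower-bound⇒positive {d} {ℓ + 10} 4<2d 2d≤) 1≤p) ⟩
  2 ^ (ℓ * (q * f d))     ≡⟨ ^-*-assoc 2 ℓ (q * f d) ⟨
  (2 ^ ℓ) ^ (q * f d)     ≤⟨ ^-monoˡ-≤ (q * f d) 2^ℓ≤d ⟩
  d ^ (q * f d)           ∎
  where
  open ≤-Reasoning
  2d≤ = lower d ℓ d<2^ℓ+1
  4<2d : 4 < 2 * d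
  4<2d = ≤-trans (s≤s (s≤s (s≤s (s≤s (s≤s z≤n))))) (*-monoʳ-≤ 2 4≤d)

asymptotic : ∀ {f} → LowerBound f → UpperBound f → AsympTo2dOverLog f
asymptotic {f} lower upper p q@(suc _) 1≤p _ = 2 ^ (2 + L) , bounds
  where
  K = (16 * (q * q) + 4) * (4 * q)
  L = K + 14 * q
  bounds : ∀ d → 2 ^ (2 + L) ≤ d → (2 ^ (2 * d * (q ∸ p)) ≤ d ^ (q * f d)) × (d ^ (q * f d) ≤ 2 ^ (2 * d * (q + p)))
  bounds d 2^[2+L]≤d = at-length (binary-length d (≤-trans (s≤s z≤n) 4≤d))
    where
    4≤d : 4 ≤ d
    4≤d = ≤-trans (m≤m*n 4 (2 ^ L) ⦃ m^n≢0 2 L ⦄) (≤-trans (≤-reflexive (sym (^-distribˡ-+-* 2 2 L))) 2^[2+L]≤d)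
    at-length : (∃ λ ℓ → 2 ^ ℓ ≤ d × d < 2 ^ suc ℓ) →
                (2 ^ (2 * d * (q ∸ p)) ≤ d ^ (q * f d)) × (d ^ (q * f d) ≤ 2 ^ (2 * d * (q + p)))
    at-length (ℓ , 2^ℓ≤d , d<2^ℓ+1) = lower-half lower q p d ℓ 1≤p 4≤d 2^ℓ≤d d<2^ℓ+1 (m+n≤o⇒n≤o K L≤ℓ) ,
                                      upper-half upper q p d ℓ 1≤p 2^ℓ≤d d<2^ℓ+1 (m+n≤o⇒m≤o K L≤ℓ)
      where
      L≤ℓ : L ≤ ℓ
      L≤ℓ = m+n≤o⇒n≤o 2 (≤-pred (2^-cancel-< (≤-<-trans 2^[2+L]≤d d<2^ℓ+1)))

module _ {Gen : ∀ d → List (Vertex d) → Set} {f : ℕ → ℕ} (minimal : ∀ d → IsMinCard (Gen d) (f d)) where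

  lower-bound : (∀ {d S} → Gen d S → ∀ ℓ → d < 2 ^ suc ℓ → 2 * d ≤ 4 + (ℓ + 10) * length S) → LowerBound f
  lower-bound bound d ℓ d<2^ℓ+1 with proj₁ (minimal d)
  ... | S , |S|≡fd , gen = subst (λ k → 2 * d ≤ 4 + (ℓ + 10) * k) |S|≡fd (bound gen ℓ d<2^ℓ+1)

  upper-bound : (∀ {d S} → MixedMetricGenerator d S → Gen d S) → UpperBound f
  upper-bound from-mixed d J t d≤ with detecting-family d J t d≤
  ... | Q , detect = subst (f d ≤_) (length-mixedGenerator Q) (proj₂ (minimal d) (mixedGenerator Q) (from-mixed (mixed-generator detect)))

corollary9 : (dimQ edimQ mdimQ : ℕ → ℕ)
    → ((d : ℕ) → IsDim d (dimQ d))
    → ((d : ℕ) → IsEdim d (edimQ d))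
    → ((d : ℕ) → IsMdim d (mdimQ d))
    → AsympTo2dOverLog mdimQ × AsympTo2dOverLog edimQ × AsympTo2dOverLog dimQ
corollary9 dimQ edimQ mdimQ isDim isEdim isMdim =
    asymptotic (lower-bound isMdim (metric-bound ∘ mixed⇒metric)) (upper-bound isMdim id)
  , asymptotic (lower-bound isEdim edge-metric-generator-lower-bound) (upper-bound isEdim mixed⇒edge)
  , asymptotic (lower-bound isDim metric-bound) (upper-bound isDim mixed⇒metric)
  where
  metric-bound : ∀ {d S} → MetricGenerator d S → ∀ ℓ → d < 2 ^ suc ℓ → 2 * d ≤ 4 + (ℓ + 10) * length S
  metric-bound resolving ℓ d<2^ℓ+1 = ≤-trans (metric-generator-lower-bound resolving ℓ d<2^ℓ+1) (+-monoˡ-≤ _ (s≤s (s≤s z≤n)))
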